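{- For every positive integer $k$ and every $\varepsilon>0$ there exists $s_0$ such that for every integer $s\ge s_0$ there exists $n_0$ such that for every $n\ge n_0$ and every $n$-vertex $k$-graph $H\in\mathcal{P}(\varepsilon,k)$, $$\delta_1\bigl(\mathrm{PG}(H,\mathcal{P}(\varepsilon/2,k),s)\bigr)\ge(1-1/s^2)\binom{n-1}{s-1}.$$
   Context: A $k$-graph $H$ has edges that are $k$-subsets of $V(H)$; $H[U]$ is the induced subgraph on $U$. For non-empty $H$, $\delta^{\ast}(H)$ is the largest $m$ such that every $(k-1)$-set contained in some edge lies in at least $m$ edges ($0$ if $H$ is empty). $\mathcal{P}(\varepsilon,k)$ is the family of $k$-graphs $H$ with $\delta^{\ast}(H)\ge(1/2+\varepsilon)|V(H)|$ and without isolated vertices. For a $k$-graph $H$ and a family $\mathcal{P}$ of $s$-vertex $k$-graphs, the property graph $\mathrm{PG}(H,\mathcal{P},s)$ is the $s$-graph on vertex set $V(H)$ whose edges are the $s$-sets $S\subseteq V(H)$ with $H[S]\in\mathcal{P}$. For an $s$-graph $P$, $\delta_1(P)$ is the minimum over vertices $v$ of the number of edges containing $v$.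
   Formalization: The parameter ε ranges over the positive rationals. -}

module Defs where

open import Data.Bool using (Bool; true; false; T; _∧_; _∨_; not)
open import Data.Nat as ℕ using (ℕ; zero; suc; _⊓_; _∸_)
open import Data.Fin using (Fin)
open import Relation.Binary.PropositionalEquality using (_≡_)
open import Data.Fin.Subset using (Subset; outside; inside; ∣_∣; ⊤)
open import Data.Fin.Subset.Properties using (_⊆?_)
open import Data.List using (List; []; _∷_; [_]; map; _++_; foldr; length; filterᵇ; allFin)
open import Data.Bool.ListAction using (all; any)
open import Data.Vec using (lookup; _∷_; [])
open import Data.Integer using (+_)
open import Data.Rational as ℚ using (ℚ; _/_; ½; _≤ᵇ_)
open import Relation.Nullary.Decidable using (⌊_⌋)

record KGraph (k n : ℕ) : Set where
  field
    edge    : Subset n → Bool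
    uniform : ∀ S → T (edge S) → ∣ S ∣ ≡ k
open KGraph public

allSubsets : (n : ℕ) → List (Subset n)
allSubsets zero    = [ [] ]
allSubsets (suc n) = map (outside ∷_) (allSubsets n) ++ map (inside ∷_) (allSubsets n)

ℕ→ℚ : ℕ → ℚ
ℕ→ℚ m = + m / 1

minList : List ℕ → ℕ
minList []       = 0
minList (x ∷ xs) = foldr _⊓_ x xs

module _ {k n : ℕ} (H : KGraph k n) where

  inducedEdge : Subset n → Subset n → Bool
  inducedEdge U S = edge H S ∧ ⌊ S ⊆? U ⌋

  codeg : Subset n → Subset n → ℕ
  codeg U A = length (filterᵇ (λ S → inducedEdge U S ∧ ⌊ A ⊆? S ⌋) (allSubsets n))

  -- δ*(H[U]): minimum of codeg over (k-1)-sets lying in some edge; 0 if there is none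
  δstar : Subset n → ℕ
  δstar U = minList (map (codeg U)
              (filterᵇ (λ A → (∣ A ∣ ℕ.≡ᵇ (k ∸ 1)) ∧ (0 ℕ.<ᵇ codeg U A)) (allSubsets n)))

  noIsolatedᵇ : Subset n → Bool
  noIsolatedᵇ U = all (λ v → not (lookup U v) ∨
                    any (λ S → inducedEdge U S ∧ lookup S v) (allSubsets n)) (allFin n)

  inPᵇ : ℚ → Subset n → Bool
  inPᵇ ε U = ((½ ℚ.+ ε) ℚ.* ℕ→ℚ ∣ U ∣ ≤ᵇ ℕ→ℚ (δstar U)) ∧ noIsolatedᵇ U

  -- degree of v in the property graph PG(H, 𝒫(ε,k), s)
  pgDeg : ℚ → ℕ → Fin n → ℕ
  pgDeg ε s v = length (filterᵇ (λ S → (∣ S ∣ ℕ.≡ᵇ s) ∧ lookup S v ∧ inPᵇ ε S) (allSubsets n))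

  δ₁PG : ℚ → ℕ → ℕ
  δ₁PG ε s = minList (map (pgDeg ε s) (allFin n))

InP : ∀ {k n} → ℚ → KGraph k n → Set
InP ε H = T (inPᵇ H ε ⊤)

module Submission where

-- Fix a vertex v and call an s-set S ∋ v bad if some B ⊆ S with |B| < k that lies in an edge of H
-- has fewer than (1/2 + ε/2)s vertices of S extending it inside an edge. A set that is not bad
-- induces a k-graph in 𝒫(ε/2): an edge of H[S] through any vertex is grown one extension at a
-- time, and every (k-1)-set in an edge of H[S] has that many extensions, i.e. codegree. For a
-- fixed B, whose extensions number at least (1/2 + ε)n - 1 by the codegree condition on H, the
-- number of extensions inside a uniformly random s-set S ⊇ B ∪ {v} is hypergeometric; below
-- (1/2 + 3ε/4)s consecutive terms of its distribution grow at least by a factor d/c > 1, so the lower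
-- tail has probability at most (s+1)(c/d)^L with L linear in s. A union bound over the at most
-- (s+1)^k sets B ⊆ S leaves at most a 1/s² fraction of the C(n-1, s-1) s-sets through v bad.

open import Data.Nat using (ℕ)
open import Data.Nat.Coprimality using (Coprime)
open import Defs

module Combinatorics where

  open import Data.Bool using (Bool; true; false; T; T?; _∧_; _∨_; not)
  open import Data.Bool.Properties using (∧-zeroʳ; ∧-identityʳ; ∧-comm; T-≡; T-∧)
  open import Data.Empty using (⊥-elim)
  open import Data.Fin using (Fin; zero; suc)
  import Data.Fin as Fin
  open import Data.Fin.Subset using (Subset; outside; inside; ⊥; ⊤; ⁅_⁆; _∪_; _∩_; _─_; ∁; ∣_∣; _⊆_; _∈_; _∉_)
  open import Data.Fin.Subset.Properties using (_⊆?_; ⊆⊤; ∣q∣≤∣p∪q∣; ∣p∩q∣≤∣q∣; ⊆-min; ⊆-trans; p─q⊆p; x∈p∩q⁻)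
  open import Data.Fin.Subset.Properties using (drop-there; anySubset?; ∣p∣≤n; p⊆p∪q; q⊆p∪q; x∈p∪q⁻; x∈⁅x⁆; x∈⁅y⁆⇒x≡y)
  open import Data.Fin.Subset.Properties using (x∈p∧x∉q⇒x∈p─q; drop-not-there; ∣p∣≤∣x∷p∣; p⊆q⇒∣p∣≤∣q∣; ∪-identityʳ)
  open import Data.Fin.Subset.Properties using (∩-zeroˡ; ∩-zeroʳ; ∣⊥∣≡0; ∣⁅x⁆∣≡1; ∣∁p∣≡n∸∣p∣)
  open import Data.List using (List; []; _∷_; map; _++_; filterᵇ; length; foldr; allFin)
  import Data.List as List
  open import Data.Bool.ListAction using (all; any)
  open import Data.List.Membership.Propositional using (lose) renaming (_∈_ to _∈ˡ_)
  open import Data.List.Membership.Propositional.Properties using (∈-map⁺; ∈-map⁻; ∈-++⁺ˡ; ∈-++⁺ʳ; ∈-filter⁺; ∈-filter⁻)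
  open import Data.List.Relation.Unary.Any as Any using ()
  open import Data.List.Relation.Unary.Any.Properties using (any⁺)
  open import Data.Nat
  open import Data.Nat.Combinatorics using (_C_; nCk+nC[k+1]≡[n+1]C[k+1]; nC1≡n)
  open import Data.Nat.DivMod using (m≡m%n+[m/n]*n; m%n<n; m*n/n≡m; /-monoˡ-≤)
  open import Data.Nat.Tactic.RingSolver using (solve-∀)
  open import Data.Nat.Properties
  open import Algebra.Properties.CommutativeSemigroup *-commutativeSemigroup using (x∙yz≈y∙xz; x∙yz≈yx∙z)
  open import Algebra.Properties.CommutativeSemigroup +-commutativeSemigroup using () renaming (interchange to +-interchange)
  open import Data.Product using (∃-syntax; _×_; _,_; proj₁; proj₂)
  open import Data.Sum using (inj₁; inj₂)
  open import Data.Vec using ([]; _∷_; here; there; lookup; tabulate)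
  open import Data.Vec.Properties using (∷-injectiveʳ; []=⇒lookup; lookup⇒[]=; lookup∘tabulate)
  open import Function.Bundles using (Equivalence)
  open import Function using (_∘_)
  open import Relation.Binary.PropositionalEquality
  open import Relation.Nullary using (¬_)
  open import Relation.Nullary.Decidable using (Dec; yes; no; ⌊_⌋; map′; toWitness; fromWitness)

  T⇒≡true : ∀ {x} → T x → x ≡ true
  T⇒≡true = Equivalence.to T-≡

  ¬T⇒≡false : ∀ {x} → ¬ T x → x ≡ false
  ¬T⇒≡false {false} _  = refl
  ¬T⇒≡false {true}  ¬T = ⊥-elim (¬T _)

  T-∧⁺ : ∀ {x y} → T x → T y → T (x ∧ y)
  T-∧⁺ Tx Ty = Equivalence.from T-∧ (Tx , Ty)

  T-∧⁻ : ∀ {x y} → T (x ∧ y) → T x × T y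
  T-∧⁻ = Equivalence.to T-∧

  T-∧⁻₃ : ∀ {x y z} → T (x ∧ y ∧ z) → T x × T y × T z
  T-∧⁻₃ {x} h = let Tx , Tyz = T-∧⁻ {x} h in Tx , T-∧⁻ Tyz

  χ : Bool → ℕ
  χ true  = 1
  χ false = 0

  χ-split : ∀ x y z w → (T x → T y → ¬ T w → T z) → χ (x ∧ y) ≤ χ (x ∧ y ∧ z) + χ ((x ∧ y) ∧ w)
  χ-split false y     z     w     _ = z≤n
  χ-split true  false z     w     _ = z≤n
  χ-split true  true  z     true  _ = m≤n+m 1 (χ z)
  χ-split true  true  true  false _ = ≤-refl
  χ-split true  true  false false z-holds = ⊥-elim (z-holds _ _ (λ ()))

  T-all-tabulate⁺ : ∀ {A : Set} {n} (p : A → Bool) (f : Fin n → A) → (∀ i → T (p (f i))) → T (all p (List.tabulate f))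
  T-all-tabulate⁺ {n = zero}  p f pf = _
  T-all-tabulate⁺ {n = suc n} p f pf = T-∧⁺ (pf zero) (T-all-tabulate⁺ p (f ∘ suc) (pf ∘ suc))

  T-all-tabulate⁻ : ∀ {A : Set} {n} (p : A → Bool) (f : Fin n → A) → T (all p (List.tabulate f)) → ∀ i → T (p (f i))
  T-all-tabulate⁻ {n = suc n} p f h zero    = proj₁ (T-∧⁻ h)
  T-all-tabulate⁻ {n = suc n} p f h (suc i) = T-all-tabulate⁻ p (f ∘ suc) (proj₂ (T-∧⁻ {p (f zero)} h)) i

  T-all-allFin⁺ : ∀ {n} {p : Fin n → Bool} → (∀ i → T (p i)) → T (all p (allFin n))
  T-all-allFin⁺ {p = p} = T-all-tabulate⁺ p (λ i → i)

  T-all-allFin⁻ : ∀ {n} {p : Fin n → Bool} → T (all p (allFin n)) → ∀ i → T (p i)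
  T-all-allFin⁻ {p = p} = T-all-tabulate⁻ p (λ i → i)

  ≡0⇒m+n≡m : ∀ {m n} → n ≡ 0 → m + n ≡ m
  ≡0⇒m+n≡m {m} refl = +-identityʳ m

  1≤q*x⇒0<x : ∀ {q x} → 1 ≤ q * x → 0 < x
  1≤q*x⇒0<x {q} {zero}  1≤q*0 = ⊥-elim (1+n≰n (≤-trans 1≤q*0 (≤-reflexive (*-zeroʳ q))))
  1≤q*x⇒0<x {q} {suc x} _     = z<s

  -- Sums and counts over the subsets of Fin n

  sumˢ : ∀ {n} → (Subset n → ℕ) → ℕ
  sumˢ {zero}  f = f []
  sumˢ {suc n} f = sumˢ (f ∘ (outside ∷_)) + sumˢ (f ∘ (inside ∷_))

  countˢ : ∀ {n} → (Subset n → Bool) → ℕ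
  countˢ P = sumˢ (χ ∘ P)

  sumˢ-cong : ∀ {n} {f g : Subset n → ℕ} → (∀ S → f S ≡ g S) → sumˢ f ≡ sumˢ g
  sumˢ-cong {zero}  f≗g = f≗g []
  sumˢ-cong {suc n} f≗g = cong₂ _+_ (sumˢ-cong (f≗g ∘ (outside ∷_))) (sumˢ-cong (f≗g ∘ (inside ∷_)))

  sumˢ-mono-≤ : ∀ {n} {f g : Subset n → ℕ} → (∀ S → f S ≤ g S) → sumˢ f ≤ sumˢ g
  sumˢ-mono-≤ {zero}  f≤g = f≤g []
  sumˢ-mono-≤ {suc n} f≤g = +-mono-≤ (sumˢ-mono-≤ (f≤g ∘ (outside ∷_))) (sumˢ-mono-≤ (f≤g ∘ (inside ∷_)))

  sumˢ-zero : ∀ {n} {f : Subset n → ℕ} → (∀ S → f S ≡ 0) → sumˢ f ≡ 0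
  sumˢ-zero {zero}  f≗0 = f≗0 []
  sumˢ-zero {suc n} f≗0 = cong₂ _+_ (sumˢ-zero (f≗0 ∘ (outside ∷_))) (sumˢ-zero (f≗0 ∘ (inside ∷_)))

  sumˢ-+ : ∀ {n} (f g : Subset n → ℕ) → sumˢ (λ S → f S + g S) ≡ sumˢ f + sumˢ g
  sumˢ-+ {zero}  f g = refl
  sumˢ-+ {suc n} f g = begin
    sumˢ (λ S → f (outside ∷ S) + g (outside ∷ S)) + sumˢ (λ S → f (inside ∷ S) + g (inside ∷ S))
      ≡⟨ cong₂ _+_ (sumˢ-+ (f ∘ (outside ∷_)) (g ∘ (outside ∷_))) (sumˢ-+ (f ∘ (inside ∷_)) (g ∘ (inside ∷_))) ⟩
    (sumˢ (f ∘ (outside ∷_)) + sumˢ (g ∘ (outside ∷_))) + (sumˢ (f ∘ (inside ∷_)) + sumˢ (g ∘ (inside ∷_)))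
      ≡⟨ +-interchange (sumˢ (f ∘ (outside ∷_))) _ _ _ ⟩
    sumˢ f + sumˢ g ∎
    where open ≡-Reasoning

  sumˢ-*ˡ : ∀ {n} (c : ℕ) (f : Subset n → ℕ) → sumˢ (λ S → c * f S) ≡ c * sumˢ f
  sumˢ-*ˡ {zero}  c f = refl
  sumˢ-*ˡ {suc n} c f = trans (cong₂ _+_ (sumˢ-*ˡ c (f ∘ (outside ∷_))) (sumˢ-*ˡ c (f ∘ (inside ∷_)))) (sym (*-distribˡ-+ c _ _))

  sumˢ-comm : ∀ {m n} (f : Subset m → Subset n → ℕ) → sumˢ (λ A → sumˢ (f A)) ≡ sumˢ (λ B → sumˢ (λ A → f A B))
  sumˢ-comm {zero}  f = refl
  sumˢ-comm {suc m} f = trans (cong₂ _+_ (sumˢ-comm (f ∘ (outside ∷_))) (sumˢ-comm (f ∘ (inside ∷_))))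
                              (sym (sumˢ-+ (λ B → sumˢ (λ A → f (outside ∷ A) B)) (λ B → sumˢ (λ A → f (inside ∷ A) B))))

  term≤sumˢ : ∀ {n} (f : Subset n → ℕ) S → f S ≤ sumˢ f
  term≤sumˢ {zero}  f []          = ≤-refl
  term≤sumˢ {suc n} f (false ∷ S) = ≤-trans (term≤sumˢ (f ∘ (outside ∷_)) S) (m≤m+n _ _)
  term≤sumˢ {suc n} f (true ∷ S)  = ≤-trans (term≤sumˢ (f ∘ (inside ∷_)) S) (m≤n+m _ _)

  sumˢ>0⇒term>0 : ∀ {n} (f : Subset n → ℕ) → 0 < sumˢ f → ∃[ S ] 0 < f S
  sumˢ>0⇒term>0 {zero}  f pos = [] , pos
  sumˢ>0⇒term>0 {suc n} f pos with sumˢ (f ∘ (outside ∷_)) in eq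
  ... | suc _ = let S , fS>0 = sumˢ>0⇒term>0 (f ∘ (outside ∷_)) (subst (0 <_) (sym eq) z<s) in outside ∷ S , fS>0
  ... | zero  = let S , fS>0 = sumˢ>0⇒term>0 (f ∘ (inside ∷_)) pos in inside ∷ S , fS>0

  countˢ-mono : ∀ {n} {P Q : Subset n → Bool} → (∀ S → T (P S) → T (Q S)) → countˢ P ≤ countˢ Q
  countˢ-mono {P = P} {Q} P⇒Q = sumˢ-mono-≤ χ-mono
    where
    χ-mono : ∀ S → χ (P S) ≤ χ (Q S)
    χ-mono S with P S | Q S | P⇒Q S
    ... | false | _     | _  = z≤n
    ... | true  | true  | _  = ≤-refl
    ... | true  | false | pq = ⊥-elim (pq _)

  countˢ-cong : ∀ {n} {P Q : Subset n → Bool} → (∀ S → P S ≡ Q S) → countˢ P ≡ countˢ Q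
  countˢ-cong P≗Q = sumˢ-cong (cong χ ∘ P≗Q)

  countˢ-none : ∀ {n} {P : Subset n → Bool} → (∀ S → P S ≡ false) → countˢ P ≡ 0
  countˢ-none P≗false = sumˢ-zero (cong χ ∘ P≗false)

  countˢ>0⇒∃ : ∀ {n} (P : Subset n → Bool) → 0 < countˢ P → ∃[ S ] T (P S)
  countˢ>0⇒∃ P pos = let S , χPS>0 = sumˢ>0⇒term>0 (χ ∘ P) pos in S , χ>0⇒T (P S) χPS>0
    where
    χ>0⇒T : ∀ b → 0 < χ b → T b
    χ>0⇒T true _ = _

  T⇒countˢ>0 : ∀ {n} (P : Subset n → Bool) S → T (P S) → 0 < countˢ P
  T⇒countˢ>0 P S PS with P S | term≤sumˢ (χ ∘ P) S
  ... | true | 1≤count = 1≤count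

  anyˢ : ∀ {n} → (Subset n → Bool) → Bool
  anyˢ P = ⌊ anySubset? (T? ∘ P) ⌋

  anyˢ⁺ : ∀ {n} {P : Subset n → Bool} S → T (P S) → T (anyˢ P)
  anyˢ⁺ S PS = fromWitness (S , PS)

  anyˢ⁻ : ∀ {n} {P : Subset n → Bool} → T (anyˢ P) → ∃[ S ] T (P S)
  anyˢ⁻ = toWitness

  allSubsets-complete : ∀ {n} (A : Subset n) → A ∈ˡ allSubsets n
  allSubsets-complete []          = Any.here refl
  allSubsets-complete (false ∷ A) = ∈-++⁺ˡ (∈-map⁺ (outside ∷_) (allSubsets-complete A))
  allSubsets-complete {suc n} (true ∷ A) = ∈-++⁺ʳ (map (outside ∷_) (allSubsets n)) (∈-map⁺ (inside ∷_) (allSubsets-complete A))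

  length-filterᵇ-allSubsets : ∀ {n} (P : Subset n → Bool) → length (filterᵇ P (allSubsets n)) ≡ countˢ P
  length-filterᵇ-allSubsets {zero} P with P []
  ... | true  = refl
  ... | false = refl
  length-filterᵇ-allSubsets {suc n} P = begin
    length (filterᵇ P (map (outside ∷_) (allSubsets n) ++ map (inside ∷_) (allSubsets n)))
      ≡⟨ length-filterᵇ-++ (map (outside ∷_) (allSubsets n)) _ ⟩
    length (filterᵇ P (map (outside ∷_) (allSubsets n))) + length (filterᵇ P (map (inside ∷_) (allSubsets n)))
      ≡⟨ cong₂ _+_ (length-filterᵇ-map (outside ∷_) (allSubsets n)) (length-filterᵇ-map (inside ∷_) (allSubsets n)) ⟩
    length (filterᵇ (P ∘ (outside ∷_)) (allSubsets n)) + length (filterᵇ (P ∘ (inside ∷_)) (allSubsets n))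
      ≡⟨ cong₂ _+_ (length-filterᵇ-allSubsets (P ∘ (outside ∷_))) (length-filterᵇ-allSubsets (P ∘ (inside ∷_))) ⟩
    countˢ P ∎
    where
    open ≡-Reasoning
    length-filterᵇ-++ : ∀ xs ys → length (filterᵇ P (xs ++ ys)) ≡ length (filterᵇ P xs) + length (filterᵇ P ys)
    length-filterᵇ-++ []       ys = refl
    length-filterᵇ-++ (x ∷ xs) ys with P x
    ... | true  = cong suc (length-filterᵇ-++ xs ys)
    ... | false = length-filterᵇ-++ xs ys
    length-filterᵇ-map : ∀ {m} (f : Subset m → Subset (suc n)) xs → length (filterᵇ P (map f xs)) ≡ length (filterᵇ (P ∘ f) xs)
    length-filterᵇ-map f []       = refl
    length-filterᵇ-map f (x ∷ xs) with P (f x)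
    ... | true  = cong suc (length-filterᵇ-map f xs)
    ... | false = length-filterᵇ-map f xs

  module _ {n} (f : Subset n → ℕ) (P : Subset n → Bool) where

    ∈-map-filter-allSubsets⁺ : ∀ {A} → T (P A) → f A ∈ˡ map f (filterᵇ P (allSubsets n))
    ∈-map-filter-allSubsets⁺ {A} PA = ∈-map⁺ f (∈-filter⁺ (T? ∘ P) (allSubsets-complete A) PA)

    ∈-map-filter-allSubsets⁻ : ∀ {y} → y ∈ˡ map f (filterᵇ P (allSubsets n)) → ∃[ A ] (T (P A) × y ≡ f A)
    ∈-map-filter-allSubsets⁻ y∈ = let A , A∈ , y≡fA = ∈-map⁻ f y∈ in A , proj₂ (∈-filter⁻ (T? ∘ P) {xs = allSubsets n} A∈) , y≡fA

  sum< : ℕ → (ℕ → ℕ) → ℕ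
  sum< zero    g = 0
  sum< (suc N) g = g N + sum< N g

  term≤sum< : ∀ N g {i} → i < N → g i ≤ sum< N g
  term≤sum< (suc N) g {i} i<1+N with i ≟ N
  ... | yes refl = m≤m+n (g i) _
  ... | no  i≢N  = ≤-trans (term≤sum< N g (≤∧≢⇒< (s≤s⁻¹ i<1+N) i≢N)) (m≤n+m _ (g N))

  sum<-mono-≤ : ∀ N {f g} → (∀ i → f i ≤ g i) → sum< N f ≤ sum< N g
  sum<-mono-≤ zero    f≤g = z≤n
  sum<-mono-≤ (suc N) f≤g = +-mono-≤ (f≤g N) (sum<-mono-≤ N f≤g)

  sum<-cong : ∀ N {f g} → (∀ i → f i ≡ g i) → sum< N f ≡ sum< N g
  sum<-cong zero    f≗g = refl
  sum<-cong (suc N) f≗g = cong₂ _+_ (f≗g N) (sum<-cong N f≗g)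

  sum<-const : ∀ N x → sum< N (λ _ → x) ≡ N * x
  sum<-const zero    x = refl
  sum<-const (suc N) x = cong (x +_) (sum<-const N x)

  sum<-*ˡ : ∀ N c g → sum< N (λ i → c * g i) ≡ c * sum< N g
  sum<-*ˡ zero    c g = sym (*-zeroʳ c)
  sum<-*ˡ (suc N) c g = trans (cong (c * g N +_) (sum<-*ˡ N c g)) (sym (*-distribˡ-+ c (g N) _))

  sumˢ-sum< : ∀ {n} N (f : ℕ → Subset n → ℕ) → sumˢ (λ S → sum< N (λ i → f i S)) ≡ sum< N (λ i → sumˢ (f i))
  sumˢ-sum< {n} zero f = sumˢ-zero {n} (λ _ → refl)
  sumˢ-sum< (suc N) f = trans (sumˢ-+ (f N) (λ S → sum< N (λ i → f i S))) (cong (sumˢ (f N) +_) (sumˢ-sum< N f))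

  countˢ-by-value : ∀ {n} N (Q R : Subset n → Bool) (f : Subset n → ℕ) (low : ℕ → Bool) →
    (∀ S → T (Q S) → T (R S) → f S < N) →
    countˢ (λ S → Q S ∧ low (f S) ∧ R S) ≤ sum< N (λ i → χ (low i) * countˢ (λ S → Q S ∧ (f S ≡ᵇ i) ∧ R S))
  countˢ-by-value N Q R f low f<N = begin
    sumˢ (λ S → χ (Q S ∧ low (f S) ∧ R S))
      ≤⟨ sumˢ-mono-≤ pointwise ⟩
    sumˢ (λ S → sum< N (λ i → χ (low i) * χ (Q S ∧ (f S ≡ᵇ i) ∧ R S)))
      ≡⟨ sumˢ-sum< N (λ i S → χ (low i) * χ (Q S ∧ (f S ≡ᵇ i) ∧ R S)) ⟩
    sum< N (λ i → sumˢ (λ S → χ (low i) * χ (Q S ∧ (f S ≡ᵇ i) ∧ R S)))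
      ≡⟨ sum<-cong N (λ i → sumˢ-*ˡ (χ (low i)) (λ S → χ (Q S ∧ (f S ≡ᵇ i) ∧ R S))) ⟩
    sum< N (λ i → χ (low i) * countˢ (λ S → Q S ∧ (f S ≡ᵇ i) ∧ R S)) ∎
    where
    open ≤-Reasoning
    pointwise : ∀ S → χ (Q S ∧ low (f S) ∧ R S) ≤ sum< N (λ i → χ (low i) * χ (Q S ∧ (f S ≡ᵇ i) ∧ R S))
    pointwise S with Q S ∧ low (f S) ∧ R S in selected
    ... | false = z≤n
    ... | true  = ≤-trans (≤-reflexive (sym term-at-f≡1)) (term≤sum< N (λ i → χ (low i) * χ (Q S ∧ (f S ≡ᵇ i) ∧ R S)) (f<N S QS RS))
      where
      chosen : T (Q S ∧ low (f S) ∧ R S)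
      chosen = subst T (sym selected) _
      QS : T (Q S)
      QS = proj₁ (T-∧⁻ chosen)
      lowfS : T (low (f S))
      lowfS = proj₁ (T-∧⁻ (proj₂ (T-∧⁻ {Q S} chosen)))
      RS : T (R S)
      RS = proj₂ (T-∧⁻ {low (f S)} (proj₂ (T-∧⁻ {Q S} chosen)))
      term-at-f≡1 : χ (low (f S)) * χ (Q S ∧ (f S ≡ᵇ f S) ∧ R S) ≡ 1
      term-at-f≡1 = cong₂ (λ x y → χ x * χ y) (T⇒≡true lowfS) (T⇒≡true (T-∧⁺ QS (T-∧⁺ (≡⇒≡ᵇ (f S) (f S) refl) RS)))

  ∣∷∣ : ∀ {n} b (p : Subset n) → ∣ b ∷ p ∣ ≡ χ b + ∣ p ∣
  ∣∷∣ true  p = refl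
  ∣∷∣ false p = refl

  -- ⌊ p ⊆? q ⌋ gets stuck on x ∷ p (Dec.map blocks the reduction), so recursive counting uses this.
  _⊆ᵇ_ : ∀ {n} → Subset n → Subset n → Bool
  []      ⊆ᵇ []      = true
  (x ∷ p) ⊆ᵇ (y ∷ q) = (not x ∨ y) ∧ (p ⊆ᵇ q)

  ⊥⊆ᵇ : ∀ {n} (p : Subset n) → ⊥ ⊆ᵇ p ≡ true
  ⊥⊆ᵇ []      = refl
  ⊥⊆ᵇ (x ∷ p) = ⊥⊆ᵇ p

  ⌊map′⌋ : ∀ {A B : Set} (f : A → B) (g : B → A) (d : Dec A) → ⌊ map′ f g d ⌋ ≡ ⌊ d ⌋
  ⌊map′⌋ f g (yes _) = refl
  ⌊map′⌋ f g (no _)  = refl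

  ⌊⊆?⌋≡⊆ᵇ : ∀ {n} (p q : Subset n) → ⌊ p ⊆? q ⌋ ≡ p ⊆ᵇ q
  ⌊⊆?⌋≡⊆ᵇ []          []          = refl
  ⌊⊆?⌋≡⊆ᵇ (false ∷ p) (y ∷ q)     = trans (⌊map′⌋ _ _ (p ⊆? q)) (⌊⊆?⌋≡⊆ᵇ p q)
  ⌊⊆?⌋≡⊆ᵇ (true ∷ p)  (false ∷ q) = refl
  ⌊⊆?⌋≡⊆ᵇ (true ∷ p)  (true ∷ q)  = trans (⌊map′⌋ _ _ (p ⊆? q)) (⌊⊆?⌋≡⊆ᵇ p q)

  ⊆ᵇ⇒⊆ : ∀ {n} {p q : Subset n} → T (p ⊆ᵇ q) → p ⊆ q
  ⊆ᵇ⇒⊆ {p = p} {q} h = toWitness (subst T (sym (⌊⊆?⌋≡⊆ᵇ p q)) h)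

  ⊆⇒⊆ᵇ : ∀ {n} {p q : Subset n} → p ⊆ q → T (p ⊆ᵇ q)
  ⊆⇒⊆ᵇ {p = p} {q} h = subst T (⌊⊆?⌋≡⊆ᵇ p q) (fromWitness (λ {x} → h {x}))

  ∈⇒T-lookup : ∀ {n} {x : Fin n} {p : Subset n} → x ∈ p → T (lookup p x)
  ∈⇒T-lookup x∈p = subst T (sym ([]=⇒lookup x∈p)) _

  T-lookup⇒∈ : ∀ {n} {x : Fin n} {p : Subset n} → T (lookup p x) → x ∈ p
  T-lookup⇒∈ h = lookup⇒[]= _ _ (Equivalence.to T-≡ h)

  ∉⇒T-not-lookup : ∀ {n} {x : Fin n} {p : Subset n} → x ∉ p → T (not (lookup p x))
  ∉⇒T-not-lookup {x = x} {p} x∉p with lookup p x in eq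
  ... | false = _
  ... | true  = x∉p (lookup⇒[]= x p eq)

  T-not-lookup⇒∉ : ∀ {n} {x : Fin n} {p : Subset n} → T (not (lookup p x)) → x ∉ p
  T-not-lookup⇒∉ {x = x} {p} h x∈p = subst (T ∘ not) ([]=⇒lookup x∈p) h

  ∈-tabulate⁺ : ∀ {n} {f : Fin n → Bool} {x} → T (f x) → x ∈ tabulate f
  ∈-tabulate⁺ {f = f} {x} h = T-lookup⇒∈ (subst T (sym (lookup∘tabulate f x)) h)

  ∈-tabulate⁻ : ∀ {n} {f : Fin n → Bool} {x} → x ∈ tabulate f → T (f x)
  ∈-tabulate⁻ {f = f} {x} x∈ = subst T (lookup∘tabulate f x) (∈⇒T-lookup x∈)

  x∈p─q⇒x∉q : ∀ {n} {x : Fin n} (p q : Subset n) → x ∈ p ─ q → x ∉ q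
  x∈p─q⇒x∉q (true ∷ p) (false ∷ q) here       = λ ()
  x∈p─q⇒x∉q (y ∷ p)    (true ∷ q)  (there x∈) = x∈p─q⇒x∉q p q x∈ ∘ drop-there
  x∈p─q⇒x∉q (y ∷ p)    (false ∷ q) (there x∈) = x∈p─q⇒x∉q p q x∈ ∘ drop-there

  x∈p⇒⁅x⁆⊆p : ∀ {n} {x : Fin n} {p} → x ∈ p → ⁅ x ⁆ ⊆ p
  x∈p⇒⁅x⁆⊆p {x = x} x∈p y∈ = subst (_∈ _) (sym (x∈⁅y⁆⇒x≡y x y∈)) x∈p

  ∪⁅⁆⊆ : ∀ {n} {p q : Subset n} {x} → p ⊆ q → x ∈ q → p ∪ ⁅ x ⁆ ⊆ q
  ∪⁅⁆⊆ {p = p} {x = x} p⊆q x∈q y∈ with x∈p∪q⁻ p ⁅ x ⁆ y∈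
  ... | inj₁ y∈p = p⊆q y∈p
  ... | inj₂ y∈x = x∈p⇒⁅x⁆⊆p x∈q y∈x

  ∣p∣>0⇒∃∈ : ∀ {n} (p : Subset n) → 0 < ∣ p ∣ → ∃[ x ] x ∈ p
  ∣p∣>0⇒∃∈ (true ∷ p)  _   = zero , here
  ∣p∣>0⇒∃∈ (false ∷ p) pos = let x , x∈p = ∣p∣>0⇒∃∈ p pos in suc x , there x∈p

  ⊆∧∣∣≤⇒≡ : ∀ {n} {A E : Subset n} → A ⊆ E → ∣ E ∣ ≤ ∣ A ∣ → A ≡ E
  ⊆∧∣∣≤⇒≡ {A = A} {E} A⊆E = go A E (⊆⇒⊆ᵇ A⊆E)
    where
    go : ∀ {n} (A E : Subset n) → T (A ⊆ᵇ E) → ∣ E ∣ ≤ ∣ A ∣ → A ≡ E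
    go []          []          _ _ = refl
    go (true ∷ A)  (true ∷ E)  h le = cong (true ∷_) (go A E h (s≤s⁻¹ le))
    go (false ∷ A) (false ∷ E) h le = cong (false ∷_) (go A E h le)
    go (false ∷ A) (true ∷ E)  h le = ⊥-elim (1+n≰n (≤-trans (s≤s (p⊆q⇒∣p∣≤∣q∣ (⊆ᵇ⇒⊆ {p = A} {E} h))) le))
    go (true ∷ A)  (false ∷ E) () le

  ∃-⊆-between : ∀ {n} {B E : Subset n} j → B ⊆ E → ∣ B ∣ ≤ j → j ≤ ∣ E ∣ → ∃[ A ] (B ⊆ A × A ⊆ E × ∣ A ∣ ≡ j)
  ∃-⊆-between {B = B} {E} j B⊆E ∣B∣≤j j≤∣E∣ with go B E j (⊆⇒⊆ᵇ B⊆E) ∣B∣≤j j≤∣E∣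
    where
    go : ∀ {n} (B E : Subset n) j → T (B ⊆ᵇ E) → ∣ B ∣ ≤ j → j ≤ ∣ E ∣ → ∃[ A ] (T (B ⊆ᵇ A) × T (A ⊆ᵇ E) × ∣ A ∣ ≡ j)
    go []          []          zero    _ _  _  = [] , _ , _ , refl
    go (false ∷ B) (false ∷ E) j       h hb he = let A , B⊆A , A⊆E , ∣A∣≡j = go B E j h hb he in false ∷ A , B⊆A , A⊆E , ∣A∣≡j
    go (true ∷ B)  (true ∷ E)  (suc j) h hb he = let A , B⊆A , A⊆E , ∣A∣≡j = go B E j h (s≤s⁻¹ hb) (s≤s⁻¹ he) in true ∷ A , B⊆A , A⊆E , cong suc ∣A∣≡j
    go (false ∷ B) (true ∷ E)  j       h hb he with j ≤? ∣ E ∣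
    ... | yes j≤∣E∣ = let A , B⊆A , A⊆E , ∣A∣≡j = go B E j h hb j≤∣E∣ in false ∷ A , B⊆A , A⊆E , ∣A∣≡j
    ... | no  j≰∣E∣ = true ∷ E , h , ⊆⇒⊆ᵇ {p = E} (λ x → x) , ≤-antisym (≰⇒> j≰∣E∣) he
    go (true ∷ B)  (false ∷ E) j       () hb he
    go (true ∷ B)  (true ∷ E)  zero    h () he
  ... | A , B⊆A , A⊆E , ∣A∣≡j = A , ⊆ᵇ⇒⊆ B⊆A , ⊆ᵇ⇒⊆ A⊆E , ∣A∣≡j

  ∣p∪q∣≤∣p∣+∣q∣ : ∀ {n} (p q : Subset n) → ∣ p ∪ q ∣ ≤ ∣ p ∣ + ∣ q ∣
  ∣p∪q∣≤∣p∣+∣q∣ []          []          = z≤n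
  ∣p∪q∣≤∣p∣+∣q∣ (true ∷ p)  (y ∷ q)     = s≤s (≤-trans (∣p∪q∣≤∣p∣+∣q∣ p q) (+-monoʳ-≤ ∣ p ∣ (∣p∣≤∣x∷p∣ y q)))
  ∣p∪q∣≤∣p∣+∣q∣ (false ∷ p) (true ∷ q)  = ≤-trans (s≤s (∣p∪q∣≤∣p∣+∣q∣ p q)) (≤-reflexive (sym (+-suc ∣ p ∣ ∣ q ∣)))
  ∣p∪q∣≤∣p∣+∣q∣ (false ∷ p) (false ∷ q) = ∣p∪q∣≤∣p∣+∣q∣ p q

  ∣p∪⁅x⁆∣≡1+∣p∣ : ∀ {n} {x : Fin n} (p : Subset n) → x ∉ p → ∣ p ∪ ⁅ x ⁆ ∣ ≡ suc ∣ p ∣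
  ∣p∪⁅x⁆∣≡1+∣p∣ {x = zero}  (true ∷ p)  x∉p = ⊥-elim (x∉p here)
  ∣p∪⁅x⁆∣≡1+∣p∣ {x = zero}  (false ∷ p) _   = cong (suc ∘ ∣_∣) (∪-identityʳ p)
  ∣p∪⁅x⁆∣≡1+∣p∣ {x = suc x} (true ∷ p)  x∉p = cong suc (∣p∪⁅x⁆∣≡1+∣p∣ p (drop-not-there x∉p))
  ∣p∪⁅x⁆∣≡1+∣p∣ {x = suc x} (false ∷ p) x∉p = ∣p∪⁅x⁆∣≡1+∣p∣ p (drop-not-there x∉p)

  ∣p∪⁅x⁆∣≤1+∣p∣ : ∀ {n} (p : Subset n) x → ∣ p ∪ ⁅ x ⁆ ∣ ≤ suc ∣ p ∣
  ∣p∪⁅x⁆∣≤1+∣p∣ p x = ≤-trans (∣p∪q∣≤∣p∣+∣q∣ p ⁅ x ⁆) (≤-reflexive (trans (cong (∣ p ∣ +_) (∣⁅x⁆∣≡1 x)) (+-comm ∣ p ∣ 1)))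

  ∣q∣+∣∁[p∪q]∣≤n : ∀ {n} (p q : Subset n) → ∣ q ∣ + ∣ ∁ (p ∪ q) ∣ ≤ n
  ∣q∣+∣∁[p∪q]∣≤n {n} p q = begin
    ∣ q ∣ + ∣ ∁ (p ∪ q) ∣         ≡⟨ cong (∣ q ∣ +_) (∣∁p∣≡n∸∣p∣ (p ∪ q)) ⟩
    ∣ q ∣ + (n ∸ ∣ p ∪ q ∣)       ≤⟨ +-monoˡ-≤ (n ∸ ∣ p ∪ q ∣) (∣q∣≤∣p∪q∣ p q) ⟩
    ∣ p ∪ q ∣ + (n ∸ ∣ p ∪ q ∣)   ≡⟨ m+[n∸m]≡n (∣p∣≤n (p ∪ q)) ⟩
    n                             ∎
    where open ≤-Reasoning

  p∩[q─p]≡⊥ : ∀ {n} (p q : Subset n) → p ∩ (q ─ p) ≡ ⊥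
  p∩[q─p]≡⊥ []          []      = refl
  p∩[q─p]≡⊥ (true ∷ p)  (y ∷ q) = cong (false ∷_) (p∩[q─p]≡⊥ p q)
  p∩[q─p]≡⊥ (false ∷ p) (y ∷ q) = cong (false ∷_) (p∩[q─p]≡⊥ p q)

  ∣p∣+∣q∩s∣≤∣s∣ : ∀ {n} (p q s : Subset n) → p ∩ q ≡ ⊥ → T (p ⊆ᵇ s) → ∣ p ∣ + ∣ q ∩ s ∣ ≤ ∣ s ∣
  ∣p∣+∣q∩s∣≤∣s∣ []          []          []          _ _ = z≤n
  ∣p∣+∣q∩s∣≤∣s∣ (true ∷ p)  (false ∷ q) (true ∷ s)  d h = s≤s (∣p∣+∣q∩s∣≤∣s∣ p q s (∷-injectiveʳ d) h)
  ∣p∣+∣q∩s∣≤∣s∣ (false ∷ p) (true ∷ q)  (true ∷ s)  d h = ≤-trans (≤-reflexive (+-suc _ _)) (s≤s (∣p∣+∣q∩s∣≤∣s∣ p q s (∷-injectiveʳ d) h))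
  ∣p∣+∣q∩s∣≤∣s∣ (false ∷ p) (false ∷ q) (true ∷ s)  d h = m≤n⇒m≤1+n (∣p∣+∣q∩s∣≤∣s∣ p q s (∷-injectiveʳ d) h)
  ∣p∣+∣q∩s∣≤∣s∣ (false ∷ p) (true ∷ q)  (false ∷ s) d h = ∣p∣+∣q∩s∣≤∣s∣ p q s (∷-injectiveʳ d) h
  ∣p∣+∣q∩s∣≤∣s∣ (false ∷ p) (false ∷ q) (false ∷ s) d h = ∣p∣+∣q∩s∣≤∣s∣ p q s (∷-injectiveʳ d) h
  ∣p∣+∣q∩s∣≤∣s∣ (true ∷ p)  (true ∷ q)  s           () h
  ∣p∣+∣q∩s∣≤∣s∣ (true ∷ p)  (false ∷ q) (false ∷ s) d ()

  count-hypergeometric : ∀ {n} (W Y : Subset n) → W ∩ Y ≡ ⊥ → ∀ i j →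
    countˢ (λ S → W ⊆ᵇ S ∧ (∣ Y ∩ S ∣ ≡ᵇ i) ∧ (∣ S ∣ ≡ᵇ ∣ W ∣ + i + j)) ≡ (∣ Y ∣ C i) * (∣ ∁ (W ∪ Y) ∣ C j)
  count-hypergeometric [] [] _ zero    zero    = refl
  count-hypergeometric [] [] _ zero    (suc j) = refl
  count-hypergeometric [] [] _ (suc i) j       = refl
  count-hypergeometric (true ∷ W)  (true ∷ Y)  () i j
  count-hypergeometric {suc n} (true ∷ W)  (false ∷ Y) d  i j =
    cong₂ _+_ (countˢ-none {n} λ _ → refl) (count-hypergeometric W Y (∷-injectiveʳ d) i j)
  count-hypergeometric (false ∷ W) (true ∷ Y)  d zero j =
    trans (cong₂ _+_ (count-hypergeometric W Y (∷-injectiveʳ d) zero j) (countˢ-none λ S → ∧-zeroʳ (W ⊆ᵇ S)))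
          (+-identityʳ _)
  count-hypergeometric (false ∷ W) (true ∷ Y)  d (suc i) j = begin
    countˢ (λ S → W ⊆ᵇ S ∧ (∣ Y ∩ S ∣ ≡ᵇ suc i) ∧ (∣ S ∣ ≡ᵇ ∣ W ∣ + suc i + j))
      + countˢ (λ S → W ⊆ᵇ S ∧ (∣ Y ∩ S ∣ ≡ᵇ i) ∧ (suc ∣ S ∣ ≡ᵇ ∣ W ∣ + suc i + j))
      ≡⟨ cong₂ _+_ (count-hypergeometric W Y W∩Y≡⊥ (suc i) j)
                   (trans (countˢ-cong λ S → cong (λ m → W ⊆ᵇ S ∧ (∣ Y ∩ S ∣ ≡ᵇ i) ∧ (suc ∣ S ∣ ≡ᵇ m)) (cong (_+ j) (+-suc ∣ W ∣ i)))
                          (count-hypergeometric W Y W∩Y≡⊥ i j)) ⟩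
    (t C suc i) * (u C j) + (t C i) * (u C j)
      ≡⟨ sym (*-distribʳ-+ (u C j) (t C suc i) (t C i)) ⟩
    (t C suc i + t C i) * (u C j)
      ≡⟨ cong (_* (u C j)) (trans (+-comm (t C suc i) (t C i)) (nCk+nC[k+1]≡[n+1]C[k+1] t i)) ⟩
    (suc t C suc i) * (u C j) ∎
    where
    open ≡-Reasoning
    W∩Y≡⊥ = ∷-injectiveʳ d
    t = ∣ Y ∣
    u = ∣ ∁ (W ∪ Y) ∣
  count-hypergeometric (false ∷ W) (false ∷ Y) d i zero =
    trans (cong₂ _+_ (count-hypergeometric W Y W∩Y≡⊥ i zero) (countˢ-none too-large)) (+-identityʳ _)
    where
    W∩Y≡⊥ = ∷-injectiveʳ d
    too-large : ∀ S → W ⊆ᵇ S ∧ (∣ Y ∩ S ∣ ≡ᵇ i) ∧ (suc ∣ S ∣ ≡ᵇ ∣ W ∣ + i + 0) ≡ false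
    too-large S = ¬T⇒≡false λ chosen → let W⊆S , ∣Y∩S∣≡i , ∣S∣≡ = T-∧⁻₃ {W ⊆ᵇ S} chosen in <-irrefl refl (begin-strict
      ∣ W ∣ + i         ≡⟨ cong (∣ W ∣ +_) (sym (≡ᵇ⇒≡ _ _ ∣Y∩S∣≡i)) ⟩
      ∣ W ∣ + ∣ Y ∩ S ∣ ≤⟨ ∣p∣+∣q∩s∣≤∣s∣ W Y S W∩Y≡⊥ W⊆S ⟩
      ∣ S ∣             <⟨ n<1+n _ ⟩
      suc ∣ S ∣         ≡⟨ ≡ᵇ⇒≡ _ _ ∣S∣≡ ⟩
      ∣ W ∣ + i + 0     ≡⟨ +-identityʳ _ ⟩
      ∣ W ∣ + i         ∎)
      where open ≤-Reasoning

  count-hypergeometric (false ∷ W) (false ∷ Y) d i (suc j) = begin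
    countˢ (λ S → W ⊆ᵇ S ∧ (∣ Y ∩ S ∣ ≡ᵇ i) ∧ (∣ S ∣ ≡ᵇ ∣ W ∣ + i + suc j))
      + countˢ (λ S → W ⊆ᵇ S ∧ (∣ Y ∩ S ∣ ≡ᵇ i) ∧ (suc ∣ S ∣ ≡ᵇ ∣ W ∣ + i + suc j))
      ≡⟨ cong₂ _+_ (count-hypergeometric W Y W∩Y≡⊥ i (suc j))
                   (trans (countˢ-cong λ S → cong (λ m → W ⊆ᵇ S ∧ (∣ Y ∩ S ∣ ≡ᵇ i) ∧ (suc ∣ S ∣ ≡ᵇ m)) (+-suc (∣ W ∣ + i) j))
                          (count-hypergeometric W Y W∩Y≡⊥ i j)) ⟩
    (t C i) * (u C suc j) + (t C i) * (u C j)
      ≡⟨ sym (*-distribˡ-+ (t C i) (u C suc j) (u C j)) ⟩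
    (t C i) * (u C suc j + u C j)
      ≡⟨ cong ((t C i) *_) (trans (+-comm (u C suc j) (u C j)) (nCk+nC[k+1]≡[n+1]C[k+1] u j)) ⟩
    (t C i) * (suc u C suc j) ∎
    where
    open ≡-Reasoning
    W∩Y≡⊥ = ∷-injectiveʳ d
    t = ∣ Y ∣
    u = ∣ ∁ (W ∪ Y) ∣

  count-∋-size : ∀ {n} (v : Fin n) s → 1 ≤ s → countˢ (λ S → (∣ S ∣ ≡ᵇ s) ∧ lookup S v) ≡ (n ∸ 1) C (s ∸ 1)
  count-∋-size {n} v s s≥1 = begin
    countˢ (λ S → (∣ S ∣ ≡ᵇ s) ∧ lookup S v)
      ≡⟨ countˢ-cong as-hypergeometric ⟩
    countˢ (λ S → ⁅ v ⁆ ⊆ᵇ S ∧ (∣ ⊥ ∩ S ∣ ≡ᵇ 0) ∧ (∣ S ∣ ≡ᵇ ∣ ⁅ v ⁆ ∣ + 0 + (s ∸ 1)))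
      ≡⟨ count-hypergeometric ⁅ v ⁆ ⊥ (∩-zeroʳ ⁅ v ⁆) 0 (s ∸ 1) ⟩
    (∣ ⊥ {n} ∣ C 0) * (∣ ∁ (⁅ v ⁆ ∪ ⊥) ∣ C (s ∸ 1))
      ≡⟨ trans (*-identityˡ _) (cong (_C (s ∸ 1)) ∣∁⁅v⁆∣≡n∸1) ⟩
    (n ∸ 1) C (s ∸ 1) ∎
    where
    open ≡-Reasoning
    ⁅v⁆⊆ᵇ≡lookup : ∀ {m} (w : Fin m) S → ⁅ w ⁆ ⊆ᵇ S ≡ lookup S w
    ⁅v⁆⊆ᵇ≡lookup zero    (x ∷ S) = trans (cong (x ∧_) (⊥⊆ᵇ S)) (∧-identityʳ x)
    ⁅v⁆⊆ᵇ≡lookup (suc w) (x ∷ S) = ⁅v⁆⊆ᵇ≡lookup w S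
    as-hypergeometric : ∀ S → (∣ S ∣ ≡ᵇ s) ∧ lookup S v ≡ ⁅ v ⁆ ⊆ᵇ S ∧ (∣ ⊥ ∩ S ∣ ≡ᵇ 0) ∧ (∣ S ∣ ≡ᵇ ∣ ⁅ v ⁆ ∣ + 0 + (s ∸ 1))
    as-hypergeometric S rewrite ⁅v⁆⊆ᵇ≡lookup v S | ∩-zeroˡ S | ∣⊥∣≡0 n | ∣⁅x⁆∣≡1 v | m+[n∸m]≡n s≥1 =
      ∧-comm (∣ S ∣ ≡ᵇ s) (lookup S v)
    ∣∁⁅v⁆∣≡n∸1 : ∣ ∁ (⁅ v ⁆ ∪ ⊥) ∣ ≡ n ∸ 1
    ∣∁⁅v⁆∣≡n∸1 = trans (∣∁p∣≡n∸∣p∣ (⁅ v ⁆ ∪ ⊥)) (cong (n ∸_) (trans (cong ∣_∣ (∪-identityʳ ⁅ v ⁆)) (∣⁅x⁆∣≡1 v)))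

  count-⊇-same-size : ∀ {n} (P : Subset n → Bool) A → countˢ (λ E → P E ∧ A ⊆ᵇ E ∧ (∣ E ∣ ≡ᵇ ∣ A ∣)) ≡ χ (P A)
  count-⊇-same-size P [] = cong χ (∧-identityʳ (P []))
  count-⊇-same-size {suc n} P (true ∷ A) =
    cong₂ _+_ (countˢ-none {n} λ E → ∧-zeroʳ (P (false ∷ E))) (count-⊇-same-size (P ∘ (true ∷_)) A)
  count-⊇-same-size {suc n} P (false ∷ A) =
    trans (cong (_+ countˢ (λ E → P (true ∷ E) ∧ A ⊆ᵇ E ∧ (suc ∣ E ∣ ≡ᵇ ∣ A ∣))) (count-⊇-same-size (P ∘ (false ∷_)) A))
          (≡0⇒m+n≡m (countˢ-none too-large))
    where
    too-large : ∀ E → P (true ∷ E) ∧ A ⊆ᵇ E ∧ (suc ∣ E ∣ ≡ᵇ ∣ A ∣) ≡ false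
    too-large E = ¬T⇒≡false λ chosen → let _ , A⊆E , ∣E∣<∣A∣ = T-∧⁻₃ {P (true ∷ E)} chosen in <-irrefl refl (begin-strict
      ∣ A ∣     ≤⟨ p⊆q⇒∣p∣≤∣q∣ (⊆ᵇ⇒⊆ {p = A} A⊆E) ⟩
      ∣ E ∣     <⟨ n<1+n _ ⟩
      suc ∣ E ∣ ≡⟨ ≡ᵇ⇒≡ _ _ ∣E∣<∣A∣ ⟩
      ∣ A ∣     ∎)
      where open ≤-Reasoning

  count-⊇-suc-size : ∀ {n} (P : Subset n → Bool) A →
    countˢ (λ E → P E ∧ A ⊆ᵇ E ∧ (∣ E ∣ ≡ᵇ suc ∣ A ∣)) ≡ ∣ tabulate (λ w → not (lookup A w) ∧ P (A ∪ ⁅ w ⁆)) ∣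
  count-⊇-suc-size P [] = cong χ (∧-zeroʳ (P []))
  count-⊇-suc-size {suc n} P (true ∷ A) =
    cong₂ _+_ (countˢ-none {n} λ E → ∧-zeroʳ (P (false ∷ E))) (count-⊇-suc-size (P ∘ (true ∷_)) A)
  count-⊇-suc-size {suc n} P (false ∷ A) = begin
    countˢ (λ E → P (false ∷ E) ∧ A ⊆ᵇ E ∧ (∣ E ∣ ≡ᵇ suc ∣ A ∣)) + countˢ (λ E → P (true ∷ E) ∧ A ⊆ᵇ E ∧ (∣ E ∣ ≡ᵇ ∣ A ∣))
      ≡⟨ cong₂ _+_ (count-⊇-suc-size (P ∘ (false ∷_)) A) (count-⊇-same-size (P ∘ (true ∷_)) A) ⟩
    ∣ tabulate (λ w → not (lookup A w) ∧ P (false ∷ (A ∪ ⁅ w ⁆))) ∣ + χ (P (true ∷ A))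
      ≡⟨ +-comm _ (χ (P (true ∷ A))) ⟩
    χ (P (true ∷ A)) + ∣ tabulate (λ w → not (lookup A w) ∧ P (false ∷ (A ∪ ⁅ w ⁆))) ∣
      ≡⟨ cong (λ B → χ (P (true ∷ B)) + ∣ tabulate (λ w → not (lookup A w) ∧ P (false ∷ (A ∪ ⁅ w ⁆))) ∣) (sym (∪-identityʳ A)) ⟩
    χ (P (true ∷ (A ∪ ⊥))) + ∣ tabulate (λ w → not (lookup A w) ∧ P (false ∷ (A ∪ ⁅ w ⁆))) ∣
      ≡⟨ sym (∣∷∣ (P (true ∷ (A ∪ ⊥))) (tabulate (λ w → not (lookup A w) ∧ P (false ∷ (A ∪ ⁅ w ⁆))))) ⟩
    ∣ tabulate (λ w → not (lookup (false ∷ A) w) ∧ P ((false ∷ A) ∪ ⁅ w ⁆)) ∣ ∎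
    where open ≡-Reasoning

  count-⊆-smaller : ∀ {n} (S : Subset n) m → countˢ (λ B → B ⊆ᵇ S ∧ (∣ B ∣ <ᵇ m)) ≤ suc ∣ S ∣ ^ m
  count-⊆-smaller [] zero    = z≤n
  count-⊆-smaller [] (suc m) = ≤-reflexive (sym (^-zeroˡ (suc m)))
  count-⊆-smaller {suc n} (false ∷ S) m =
    ≤-trans (≤-reflexive (≡0⇒m+n≡m (countˢ-none {n} λ _ → refl))) (count-⊆-smaller S m)
  count-⊆-smaller {suc n} (true ∷ S) zero =
    ≤-trans (≤-reflexive (≡0⇒m+n≡m (countˢ-none {n} λ B → ∧-zeroʳ (B ⊆ᵇ S)))) (count-⊆-smaller S 0)
  count-⊆-smaller {suc n} (true ∷ S) (suc m) = begin
    countˢ (λ B → B ⊆ᵇ S ∧ (∣ B ∣ <ᵇ suc m)) + countˢ (λ B → B ⊆ᵇ S ∧ (∣ B ∣ <ᵇ m))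
      ≤⟨ +-mono-≤ (count-⊆-smaller S (suc m)) (count-⊆-smaller S m) ⟩
    x * x ^ m + x ^ m  ≡⟨ +-comm (x * x ^ m) (x ^ m) ⟩
    suc x * x ^ m      ≤⟨ *-monoʳ-≤ (suc x) (^-monoˡ-≤ m (n≤1+n x)) ⟩
    suc x * suc x ^ m  ∎
    where
    open ≤-Reasoning
    x = suc ∣ S ∣

  minList-≤ : ∀ {xs y} → y ∈ˡ xs → minList xs ≤ y
  minList-≤ {x ∷ xs} = foldr⊓-≤ {xs = xs}
    where
    foldr⊓-≤ : ∀ {x xs y} → y ∈ˡ x ∷ xs → foldr _⊓_ x xs ≤ y
    foldr⊓-≤ {xs = []}     (Any.here refl)         = ≤-refl
    foldr⊓-≤ {xs = z ∷ zs} (Any.here refl)         = ≤-trans (m⊓n≤n z _) (foldr⊓-≤ {xs = zs} (Any.here refl))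
    foldr⊓-≤ {xs = z ∷ zs} (Any.there (Any.here refl)) = m⊓n≤m z _
    foldr⊓-≤ {xs = z ∷ zs} (Any.there (Any.there y∈)) = ≤-trans (m⊓n≤n z _) (foldr⊓-≤ {xs = zs} (Any.there y∈))

  minList-≤-all : ∀ {xs m} → (∀ {z} → z ∈ˡ xs → z ≤ m) → minList xs ≤ m
  minList-≤-all {[]}    _   = z≤n
  minList-≤-all {x ∷ xs} ≤m = ≤-trans (minList-≤ {x ∷ xs} (Any.here refl)) (≤m (Any.here refl))

  minList-∈ : ∀ {xs y} → y ∈ˡ xs → minList xs ∈ˡ xs
  minList-∈ {x ∷ xs} _ = foldr⊓-∈ x xs
    where
    foldr⊓-∈ : ∀ x xs → foldr _⊓_ x xs ∈ˡ x ∷ xs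
    foldr⊓-∈ x []       = Any.here refl
    foldr⊓-∈ x (z ∷ zs) with ⊓-sel z (foldr _⊓_ x zs)
    ... | inj₁ min≡z = Any.there (Any.here min≡z)
    ... | inj₂ min≡rest with foldr⊓-∈ x zs
    ...   | Any.here rest≡x   = Any.here (trans min≡rest rest≡x)
    ...   | Any.there rest∈zs = Any.there (Any.there (subst (_∈ˡ zs) (sym min≡rest) rest∈zs))

  -- Codegrees and extensions in a k-graph

  module _ {k n : ℕ} (H : KGraph k n) where

    InEdge : Subset n → Set
    InEdge B = ∃[ E ] (T (edge H E) × B ⊆ E)

    inEdgeᵇ : Subset n → Bool
    inEdgeᵇ B = anyˢ (λ E → edge H E ∧ B ⊆ᵇ E)

    inEdgeᵇ⇒InEdge : ∀ {B} → T (inEdgeᵇ B) → InEdge B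
    inEdgeᵇ⇒InEdge h = let E , p = anyˢ⁻ h ; edgeE , B⊆E = T-∧⁻ p in E , edgeE , ⊆ᵇ⇒⊆ B⊆E

    InEdge⇒inEdgeᵇ : ∀ {B} → InEdge B → T (inEdgeᵇ B)
    InEdge⇒inEdgeᵇ (E , edgeE , B⊆E) = anyˢ⁺ E (T-∧⁺ edgeE (⊆⇒⊆ᵇ B⊆E))

    edge⊇⇒≡ : ∀ {B E} → T (edge H E) → B ⊆ E → k ≤ ∣ B ∣ → B ≡ E
    edge⊇⇒≡ {E = E} edgeE B⊆E k≤∣B∣ = ⊆∧∣∣≤⇒≡ B⊆E (subst (_≤ _) (sym (uniform H E edgeE)) k≤∣B∣)

    reach : Subset n → Subset n
    reach B = tabulate λ w → anyˢ λ E → (edge H E ∧ B ⊆ᵇ E) ∧ lookup E w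

    ∈-reach⁺ : ∀ {B E w} → T (edge H E) → B ⊆ E → w ∈ E → w ∈ reach B
    ∈-reach⁺ {E = E} edgeE B⊆E w∈E = ∈-tabulate⁺ (anyˢ⁺ E (T-∧⁺ (T-∧⁺ edgeE (⊆⇒⊆ᵇ B⊆E)) (∈⇒T-lookup w∈E)))

    ∈-reach⁻ : ∀ {B w} → w ∈ reach B → ∃[ E ] (T (edge H E) × B ⊆ E × w ∈ E)
    ∈-reach⁻ w∈ = let E , p = anyˢ⁻ (∈-tabulate⁻ w∈) ; q , w∈E = T-∧⁻ p ; edgeE , B⊆E = T-∧⁻ q in
      E , edgeE , ⊆ᵇ⇒⊆ B⊆E , T-lookup⇒∈ w∈E

    nbhd : Subset n → Subset n → Subset n
    nbhd U A = tabulate λ w → not (lookup A w) ∧ inducedEdge H U (A ∪ ⁅ w ⁆)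

    ∈-nbhd⁺ : ∀ {U A w} → w ∉ A → T (edge H (A ∪ ⁅ w ⁆)) → A ∪ ⁅ w ⁆ ⊆ U → w ∈ nbhd U A
    ∈-nbhd⁺ w∉A edge⁺ ⊆U = ∈-tabulate⁺ (T-∧⁺ (∉⇒T-not-lookup w∉A) (T-∧⁺ edge⁺ (fromWitness (λ {x} → ⊆U {x}))))

    ∈-nbhd⁻ : ∀ {U A w} → w ∈ nbhd U A → w ∉ A × T (edge H (A ∪ ⁅ w ⁆)) × A ∪ ⁅ w ⁆ ⊆ U
    ∈-nbhd⁻ w∈ = let w∉A , p = T-∧⁻ (∈-tabulate⁻ w∈) ; edge⁺ , ⊆U = T-∧⁻ p in
      T-not-lookup⇒∉ w∉A , edge⁺ , toWitness ⊆U

    codeg≡countˢ : ∀ U A → codeg H U A ≡ countˢ (λ E → inducedEdge H U E ∧ A ⊆ᵇ E)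
    codeg≡countˢ U A = trans (length-filterᵇ-allSubsets (λ E → inducedEdge H U E ∧ ⌊ A ⊆? E ⌋)) (countˢ-cong λ E → cong (inducedEdge H U E ∧_) (⌊⊆?⌋≡⊆ᵇ A E))

    codeg≡∣nbhd∣ : 1 ≤ k → ∀ U A → ∣ A ∣ ≡ k ∸ 1 → codeg H U A ≡ ∣ nbhd U A ∣
    codeg≡∣nbhd∣ k≥1 U A ∣A∣≡k-1 = trans (codeg≡countˢ U A) (trans (countˢ-cong edges-are-one-larger) (count-⊇-suc-size (inducedEdge H U) A))
      where
      edges-are-one-larger : ∀ E → inducedEdge H U E ∧ A ⊆ᵇ E ≡ inducedEdge H U E ∧ A ⊆ᵇ E ∧ (∣ E ∣ ≡ᵇ suc ∣ A ∣)
      edges-are-one-larger E with edge H E in edgeE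
      ... | false = refl
      ... | true  = trans (cong (⌊ E ⊆? U ⌋ ∧_) (sym (∧-identityʳ (A ⊆ᵇ E))))
                          (cong (λ b → ⌊ E ⊆? U ⌋ ∧ A ⊆ᵇ E ∧ b) (sym (T⇒≡true (≡⇒≡ᵇ ∣ E ∣ (suc ∣ A ∣) ∣E∣≡1+∣A∣))))
        where
        ∣E∣≡1+∣A∣ : ∣ E ∣ ≡ suc ∣ A ∣
        ∣E∣≡1+∣A∣ = trans (uniform H E (subst T (sym edgeE) _)) (trans (sym (m+[n∸m]≡n k≥1)) (cong suc (sym ∣A∣≡k-1)))

    codeg>0⇒∃edge : ∀ {U A} → 0 < codeg H U A → ∃[ E ] (T (edge H E) × E ⊆ U × A ⊆ E)
    codeg>0⇒∃edge {U} {A} pos =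
      let E , p = countˢ>0⇒∃ (λ E → inducedEdge H U E ∧ A ⊆ᵇ E) (subst (0 <_) (codeg≡countˢ U A) pos)
          q , A⊆E = T-∧⁻ p ; edgeE , E⊆U = T-∧⁻ q
      in E , edgeE , toWitness E⊆U , ⊆ᵇ⇒⊆ A⊆E

    edge⇒codeg>0 : ∀ {U A E} → T (edge H E) → E ⊆ U → A ⊆ E → 0 < codeg H U A
    edge⇒codeg>0 {U} {A} {E} edgeE E⊆U A⊆E = subst (0 <_) (sym (codeg≡countˢ U A))
      (T⇒countˢ>0 (λ E → inducedEdge H U E ∧ A ⊆ᵇ E) E (T-∧⁺ (T-∧⁺ edgeE (fromWitness (λ {x} → E⊆U {x}))) (⊆⇒⊆ᵇ A⊆E)))

    private
      positive-codeg : Subset n → Subset n → Bool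
      positive-codeg U A = (∣ A ∣ ≡ᵇ (k ∸ 1)) ∧ (0 <ᵇ codeg H U A)

      ∈-codegrees⁻ : ∀ {U y} → y ∈ˡ map (codeg H U) (filterᵇ (positive-codeg U) (allSubsets n)) →
                     ∃[ A ] (∣ A ∣ ≡ k ∸ 1 × 0 < codeg H U A × y ≡ codeg H U A)
      ∈-codegrees⁻ {U} y∈ = let A , p , y≡ = ∈-map-filter-allSubsets⁻ (codeg H U) (positive-codeg U) y∈ ; ∣A∣ , pos = T-∧⁻ p in
        A , ≡ᵇ⇒≡ _ _ ∣A∣ , <ᵇ⇒< 0 _ pos , y≡

    δstar≤codeg : ∀ {U A} → ∣ A ∣ ≡ k ∸ 1 → 0 < codeg H U A → δstar H U ≤ codeg H U A
    δstar≤codeg {U} {A} ∣A∣≡ pos = minList-≤ (∈-map-filter-allSubsets⁺ (codeg H U) (positive-codeg U) (T-∧⁺ (≡⇒≡ᵇ _ _ ∣A∣≡) (<⇒<ᵇ pos)))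

    δstar≤n : 1 ≤ k → ∀ U → δstar H U ≤ n
    δstar≤n k≥1 U = minList-≤-all λ y∈ → let A , ∣A∣≡ , _ , y≡ = ∈-codegrees⁻ y∈ in
      ≤-trans (≤-reflexive (trans y≡ (codeg≡∣nbhd∣ k≥1 U A ∣A∣≡))) (∣p∣≤n (nbhd U A))

    δstar-attained : ∀ {U A₀} → ∣ A₀ ∣ ≡ k ∸ 1 → 0 < codeg H U A₀ →
                     ∃[ A ] (∣ A ∣ ≡ k ∸ 1 × 0 < codeg H U A × δstar H U ≡ codeg H U A)
    δstar-attained {U} ∣A₀∣≡ pos =
      ∈-codegrees⁻ (minList-∈ (∈-map-filter-allSubsets⁺ (codeg H U) (positive-codeg U) (T-∧⁺ (≡⇒≡ᵇ _ _ ∣A₀∣≡) (<⇒<ᵇ pos))))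

    module _ (v : Fin n) where

      -- Excluding v makes B ∪ ⁅ v ⁆ and extensions B disjoint, as count-hypergeometric needs.
      extensions : Subset n → Subset n
      extensions B = reach B ─ (B ∪ ⁅ v ⁆)

      ∈-extensions⁻ : ∀ {B w} → w ∈ extensions B → w ∉ B × ∃[ E ] (T (edge H E) × B ⊆ E × w ∈ E)
      ∈-extensions⁻ {B} w∈ = x∈p─q⇒x∉q (reach B) (B ∪ ⁅ v ⁆) w∈ ∘ p⊆p∪q ⁅ v ⁆ , ∈-reach⁻ (p─q⊆p (reach B) (B ∪ ⁅ v ⁆) w∈)

      extensions-disjoint : ∀ B → (B ∪ ⁅ v ⁆) ∩ extensions B ≡ ⊥
      extensions-disjoint B = p∩[q─p]≡⊥ (B ∪ ⁅ v ⁆) (reach B)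

      ∣nbhd∣≤∣extensions∣+1 : ∀ {A B} → B ⊆ A → ∣ nbhd ⊤ A ∣ ≤ ∣ extensions B ∣ + 1
      ∣nbhd∣≤∣extensions∣+1 {A} {B} B⊆A = begin
        ∣ nbhd ⊤ A ∣                ≤⟨ p⊆q⇒∣p∣≤∣q∣ nbhd⊆ ⟩
        ∣ extensions B ∪ ⁅ v ⁆ ∣    ≤⟨ ∣p∪⁅x⁆∣≤1+∣p∣ (extensions B) v ⟩
        suc ∣ extensions B ∣        ≡⟨ +-comm 1 _ ⟩
        ∣ extensions B ∣ + 1        ∎
        where
        open ≤-Reasoning
        nbhd⊆ : nbhd ⊤ A ⊆ extensions B ∪ ⁅ v ⁆
        nbhd⊆ {w} w∈ with w Fin.≟ v | ∈-nbhd⁻ w∈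
        ... | yes refl | _               = q⊆p∪q (extensions B) ⁅ v ⁆ (x∈⁅x⁆ v)
        ... | no  w≢v  | w∉A , edge⁺ , _ = p⊆p∪q ⁅ v ⁆ (x∈p∧x∉q⇒x∈p─q w∈reach w∉B∪v)
          where
          w∈reach : w ∈ reach B
          w∈reach = ∈-reach⁺ edge⁺ (⊆-trans B⊆A (p⊆p∪q ⁅ w ⁆)) (q⊆p∪q A ⁅ w ⁆ (x∈⁅x⁆ w))
          w∉B∪v : w ∉ B ∪ ⁅ v ⁆
          w∉B∪v w∈B∪v with x∈p∪q⁻ B ⁅ v ⁆ w∈B∪v
          ... | inj₁ w∈B = w∉A (B⊆A w∈B)
          ... | inj₂ w∈v = w≢v (x∈⁅y⁆⇒x≡y v w∈v)

      extensions∩⊆nbhd : 1 ≤ k → ∀ {A S} → ∣ A ∣ ≡ k ∸ 1 → A ⊆ S → extensions A ∩ S ⊆ nbhd S A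
      extensions∩⊆nbhd k≥1 {A} {S} ∣A∣≡ A⊆S {w} w∈ with x∈p∩q⁻ (extensions A) S w∈
      ... | w∈ext , w∈S with ∈-extensions⁻ w∈ext
      ...   | w∉A , E , edgeE , A⊆E , w∈E = ∈-nbhd⁺ w∉A (subst (T ∘ edge H) (sym A∪w≡E) edgeE) (∪⁅⁆⊆ A⊆S w∈S)
        where
        A∪w≡E : A ∪ ⁅ w ⁆ ≡ E
        A∪w≡E = edge⊇⇒≡ edgeE (∪⁅⁆⊆ A⊆E w∈E)
          (≤-reflexive (trans (sym (m+[n∸m]≡n k≥1)) (trans (cong suc (sym ∣A∣≡)) (sym (∣p∪⁅x⁆∣≡1+∣p∣ A w∉A)))))

      module _ (q θ : ℕ) (θ≥1 : 1 ≤ θ) {S : Subset n}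
               (good : ∀ {B} → B ⊆ S → ∣ B ∣ < k → InEdge B → θ ≤ q * ∣ extensions B ∩ S ∣) where

        grow : ∀ m {B} → ∣ B ∣ + m ≡ k → B ⊆ S → InEdge B → ∃[ E ] (T (edge H E) × B ⊆ E × E ⊆ S)
        grow zero {B} ∣B∣+0≡k B⊆S (E , edgeE , B⊆E) =
          E , edgeE , B⊆E , subst (_⊆ S) (edge⊇⇒≡ edgeE B⊆E (≤-reflexive (trans (sym ∣B∣+0≡k) (+-identityʳ _)))) B⊆S
        grow (suc m) {B} ∣B∣+1+m≡k B⊆S inB
          with ∣p∣>0⇒∃∈ _ (1≤q*x⇒0<x {q} (≤-trans θ≥1 (good B⊆S (subst (∣ B ∣ <_) ∣B∣+1+m≡k (m<m+n ∣ B ∣ z<s)) inB)))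
        ... | w , w∈ with x∈p∩q⁻ (extensions B) S w∈
        ...   | w∈ext , w∈S with ∈-extensions⁻ w∈ext
        ...     | w∉B , E , edgeE , B⊆E , w∈E with grow m (trans (cong (_+ m) (∣p∪⁅x⁆∣≡1+∣p∣ B w∉B)) (trans (sym (+-suc ∣ B ∣ m)) ∣B∣+1+m≡k))
                                                          (∪⁅⁆⊆ B⊆S w∈S) (E , edgeE , ∪⁅⁆⊆ B⊆E w∈E)
        ...       | E′ , edgeE′ , B∪w⊆E′ , E′⊆S = E′ , edgeE′ , ⊆-trans (p⊆p∪q ⁅ w ⁆) B∪w⊆E′ , E′⊆S

        edge-through : 1 ≤ k → ∀ {u} → u ∈ S → InEdge ⁅ u ⁆ → ∃[ E ] (T (edge H E) × u ∈ E × E ⊆ S)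
        edge-through k≥1 {u} u∈S inU =
          let E , edgeE , u⊆E , E⊆S = grow (k ∸ 1) (trans (cong (_+ (k ∸ 1)) (∣⁅x⁆∣≡1 u)) (m+[n∸m]≡n k≥1)) (x∈p⇒⁅x⁆⊆p u∈S) inU
          in E , edgeE , u⊆E (x∈⁅x⁆ u) , E⊆S

        noIsolated : 1 ≤ k → (∀ u → InEdge ⁅ u ⁆) → T (noIsolatedᵇ H S)
        noIsolated k≥1 inU = T-all-allFin⁺ lies-in-edge
          where
          lies-in-edge : ∀ u → T (not (lookup S u) ∨ any (λ E → inducedEdge H S E ∧ lookup E u) (allSubsets n))
          lies-in-edge u with lookup S u in u∈S
          ... | false = _
          ... | true  = let E , edgeE , u∈E , E⊆S = edge-through k≥1 (lookup⇒[]= u S u∈S) (inU u) in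
            any⁺ _ (lose (allSubsets-complete E) (T-∧⁺ (T-∧⁺ edgeE (fromWitness (λ {x} → E⊆S {x}))) (∈⇒T-lookup u∈E)))

        θ≤q*δstar : 1 ≤ k → ∀ {u} → u ∈ S → InEdge ⁅ u ⁆ → θ ≤ q * δstar H S
        θ≤q*δstar k≥1 u∈S inU with edge-through k≥1 u∈S inU
        ... | E , edgeE , _ , E⊆S
          with ∃-⊆-between (k ∸ 1) (⊆-min E) (subst (_≤ k ∸ 1) (sym (∣⊥∣≡0 n)) z≤n) (≤-trans (m∸n≤m k 1) (≤-reflexive (sym (uniform H E edgeE))))
        ... | A₀ , _ , A₀⊆E , ∣A₀∣≡ with δstar-attained ∣A₀∣≡ (edge⇒codeg>0 edgeE E⊆S A₀⊆E)
        ... | A , ∣A∣≡ , pos , δ≡ with codeg>0⇒∃edge pos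
        ... | E′ , edgeE′ , E′⊆S , A⊆E′ = begin
          θ                        ≤⟨ good A⊆S ∣A∣<k (E′ , edgeE′ , A⊆E′) ⟩
          q * ∣ extensions A ∩ S ∣ ≤⟨ *-monoʳ-≤ q (p⊆q⇒∣p∣≤∣q∣ (extensions∩⊆nbhd k≥1 ∣A∣≡ A⊆S)) ⟩
          q * ∣ nbhd S A ∣         ≡⟨ cong (q *_) (sym (trans δ≡ (codeg≡∣nbhd∣ k≥1 S A ∣A∣≡))) ⟩
          q * δstar H S            ∎
          where
          open ≤-Reasoning
          A⊆S = ⊆-trans A⊆E′ E′⊆S
          ∣A∣<k : ∣ A ∣ < k
          ∣A∣<k = ≤-trans (s≤s (≤-reflexive ∣A∣≡)) (≤-reflexive (m+[n∸m]≡n k≥1))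

  -- Ratios of consecutive hypergeometric terms

  C-vanishes : ∀ t j → t < j → t C j ≡ 0
  C-vanishes zero    (suc j) _   = refl
  C-vanishes (suc t) (suc j) t<j = begin
    suc t C suc j       ≡⟨ sym (nCk+nC[k+1]≡[n+1]C[k+1] t j) ⟩
    t C j + t C suc j   ≡⟨ cong₂ _+_ (C-vanishes t j (s≤s⁻¹ t<j)) (C-vanishes t (suc j) (m<n⇒m<1+n (s≤s⁻¹ t<j))) ⟩
    0                   ∎
    where open ≡-Reasoning

  C-absorb : ∀ t j → (t C j) * (t ∸ j) ≡ (t C suc j) * suc j
  C-absorb zero    j    = trans (cong ((0 C j) *_) (0∸n≡0 j)) (*-zeroʳ (0 C j))
  C-absorb (suc t) zero = trans (*-identityˡ (suc t)) (sym (trans (*-identityʳ _) (nC1≡n (suc t))))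
  C-absorb (suc t) (suc j) with j <? t
  ... | yes j<t = begin
    (suc t C suc j) * (t ∸ j)                                 ≡⟨ cong (_* (t ∸ j)) (sym (nCk+nC[k+1]≡[n+1]C[k+1] t j)) ⟩
    (t C j + t C suc j) * (t ∸ j)                             ≡⟨ *-distribʳ-+ (t ∸ j) (t C j) (t C suc j) ⟩
    (t C j) * (t ∸ j) + (t C suc j) * (t ∸ j)                 ≡⟨ cong₂ _+_ (C-absorb t j) (cong ((t C suc j) *_) (+-∸-assoc 1 j<t)) ⟩
    (t C suc j) * suc j + (t C suc j) * suc (t ∸ suc j)       ≡⟨ shift (t C suc j) (suc j) (t ∸ suc j) ⟩
    (t C suc j) * suc (suc j) + (t C suc j) * (t ∸ suc j)     ≡⟨ cong ((t C suc j) * suc (suc j) +_) (C-absorb t (suc j)) ⟩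
    (t C suc j) * suc (suc j) + (t C suc (suc j)) * suc (suc j) ≡⟨ sym (*-distribʳ-+ (suc (suc j)) (t C suc j) _) ⟩
    (t C suc j + t C suc (suc j)) * suc (suc j)               ≡⟨ cong (_* suc (suc j)) (nCk+nC[k+1]≡[n+1]C[k+1] t (suc j)) ⟩
    (suc t C suc (suc j)) * suc (suc j)                       ∎
    where
    open ≡-Reasoning
    shift : ∀ x y z → x * y + x * suc z ≡ x * suc y + x * z
    shift = solve-∀
  ... | no j≮t = trans (cong ((suc t C suc j) *_) (m≤n⇒m∸n≡0 (≮⇒≥ j≮t))) (trans (*-zeroʳ (suc t C suc j))
                   (sym (cong (_* suc (suc j)) (C-vanishes (suc t) (suc (suc j)) (s≤s (s≤s (≮⇒≥ j≮t)))))))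

  hypergeometric : ℕ → ℕ → ℕ → ℕ → ℕ
  hypergeometric t u r j = (t C j) * (u C (r ∸ j))

  hypergeometric-ratio : ∀ t u r j → j < r →
    hypergeometric t u r j * ((t ∸ j) * (r ∸ j)) ≡ hypergeometric t u r (suc j) * (suc j * (u ∸ (r ∸ suc j)))
  hypergeometric-ratio t u r j j<r = begin
    (t C j) * (u C (r ∸ j)) * ((t ∸ j) * (r ∸ j))             ≡⟨ cong (λ m → (t C j) * (u C m) * ((t ∸ j) * m)) r-j≡1+m ⟩
    (t C j) * (u C suc m) * ((t ∸ j) * suc m)                 ≡⟨ regroup ((t C j)) (u C suc m) (t ∸ j) (suc m) ⟩
    ((t C j) * (t ∸ j)) * ((u C suc m) * suc m)               ≡⟨ cong₂ _*_ (C-absorb t j) (sym (C-absorb u m)) ⟩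
    ((t C suc j) * suc j) * ((u C m) * (u ∸ m))               ≡⟨ regroup (t C suc j) (suc j) (u C m) (u ∸ m) ⟩
    (t C suc j) * (u C m) * (suc j * (u ∸ m))                 ∎
    where
    open ≡-Reasoning
    m = r ∸ suc j
    r-j≡1+m : r ∸ j ≡ suc m
    r-j≡1+m = +-∸-assoc 1 j<r
    regroup : ∀ w x y z → w * x * (y * z) ≡ (w * y) * (x * z)
    regroup = solve-∀

  hypergeometric-step : ∀ c d t u r j → j < r → 0 < (t ∸ j) * (r ∸ j) →
    d * (suc j * (u ∸ (r ∸ suc j))) ≤ c * ((t ∸ j) * (r ∸ j)) →
    d * hypergeometric t u r j ≤ c * hypergeometric t u r (suc j)
  hypergeometric-step c d t u r j j<r pos ratio≤ = *-cancelʳ-≤ (d * h j) (c * h (suc j)) X ⦃ >-nonZero pos ⦄ (begin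
    d * h j * X           ≡⟨ *-assoc d (h j) X ⟩
    d * (h j * X)         ≡⟨ cong (d *_) (hypergeometric-ratio t u r j j<r) ⟩
    d * (h (suc j) * Y)   ≡⟨ x∙yz≈y∙xz d (h (suc j)) Y ⟩
    h (suc j) * (d * Y)   ≤⟨ *-monoʳ-≤ (h (suc j)) ratio≤ ⟩
    h (suc j) * (c * X)   ≡⟨ x∙yz≈yx∙z (h (suc j)) c X ⟩
    c * h (suc j) * X     ∎)
    where
    open ≤-Reasoning
    h = hypergeometric t u r
    X = (t ∸ j) * (r ∸ j)
    Y = suc j * (u ∸ (r ∸ suc j))

  geometric-chain : (h : ℕ → ℕ) (c d i L : ℕ) → (∀ m → m < L → d * h (i + m) ≤ c * h (suc (i + m))) →
    d ^ L * h i ≤ c ^ L * h (i + L)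
  geometric-chain h c d i zero    step = ≤-reflexive (trans (*-identityˡ (h i)) (sym (trans (*-identityˡ _) (cong h (+-identityʳ i)))))
  geometric-chain h c d i (suc L) step = begin
    d * d ^ L * h i               ≡⟨ *-assoc d (d ^ L) (h i) ⟩
    d * (d ^ L * h i)             ≤⟨ *-monoʳ-≤ d (geometric-chain h c d i L (λ m m<L → step m (m<n⇒m<1+n m<L))) ⟩
    d * (c ^ L * h (i + L))       ≡⟨ x∙yz≈y∙xz d (c ^ L) (h (i + L)) ⟩
    c ^ L * (d * h (i + L))       ≤⟨ *-monoʳ-≤ (c ^ L) (step L ≤-refl) ⟩
    c ^ L * (c * h (suc (i + L))) ≡⟨ trans (x∙yz≈y∙xz (c ^ L) c _) (sym (*-assoc c (c ^ L) _)) ⟩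
    c * c ^ L * h (suc (i + L))   ≡⟨ cong (λ m → c * c ^ L * h m) (sym (+-suc i L)) ⟩
    c * c ^ L * h (i + suc L)     ∎
    where open ≤-Reasoning

  scale-bound : ∀ {x y m E X} → E ≤ m * y → m * x ≤ X → x * E ≤ X * y
  scale-bound {x} {y} {m} {E} {X} E≤my mx≤X = begin
    x * E       ≤⟨ *-monoʳ-≤ x E≤my ⟩
    x * (m * y) ≡⟨ x∙yz≈y∙xz x m y ⟩
    m * (x * y) ≡⟨ sym (*-assoc m x y) ⟩
    m * x * y   ≤⟨ *-monoˡ-≤ y mx≤X ⟩
    X * y       ∎
    where open ≤-Reasoning

  product-bound : ∀ {c d x u y z E F X U} → x * E ≤ X * y → u * F ≤ U * z → d * X * U ≤ c * E * F → 0 < E * F →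
    d * x * u ≤ c * (z * y)
  product-bound {c} {d} {x} {u} {y} {z} {E} {F} {X} {U} xE≤Xy uF≤Uz dXU≤cEF EF>0 =
    *-cancelʳ-≤ (d * x * u) (c * (z * y)) (E * F) ⦃ >-nonZero EF>0 ⦄ (begin
      d * x * u * (E * F)         ≡⟨ regroup₁ d x u E F ⟩
      d * ((x * E) * (u * F))     ≤⟨ *-monoʳ-≤ d (*-mono-≤ xE≤Xy uF≤Uz) ⟩
      d * ((X * y) * (U * z))     ≡⟨ regroup₂ d X y U z ⟩
      (d * X * U) * (z * y)       ≤⟨ *-monoˡ-≤ (z * y) dXU≤cEF ⟩
      (c * E * F) * (z * y)       ≡⟨ regroup₃ c E F (z * y) ⟩
      c * (z * y) * (E * F)       ∎)
    where
    open ≤-Reasoning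
    regroup₁ : ∀ d x u E F → d * x * u * (E * F) ≡ d * ((x * E) * (u * F))
    regroup₁ = solve-∀
    regroup₂ : ∀ d X y U z → d * ((X * y) * (U * z)) ≡ (d * X * U) * (z * y)
    regroup₂ = solve-∀
    regroup₃ : ∀ c E F w → (c * E * F) * w ≡ c * w * (E * F)
    regroup₃ = solve-∀

  -- The lower tail of the hypergeometric distribution

  module Tail (a e k : ℕ) (a≥1 : 1 ≤ a) where

    -- With ε = a/b: P/2b = 1/2 + ε, A⁺/4b = 1/2 + 3ε/4, A⁻/4b = 1/2 - 3ε/4 and e/2b = 1/2 - ε.
    -- Below A⁺s/4b the hypergeometric terms grow by at least about A⁻P/(A⁺e) = d/(2A⁺e), and
    -- c = 2A⁺e + 2ab sits strictly between 2A⁺e and d = c + 2ab.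
    b P A⁺ A⁻ c d : ℕ
    b  = 2 * a + e
    P  = 4 * a + e
    A⁺ = 7 * a + 2 * e
    A⁻ = a + 2 * e
    c  = 2 * A⁺ * e + 2 * a * b
    d  = 2 * A⁻ * P

    A⁺+A⁻≡4b : A⁺ + A⁻ ≡ 4 * b
    A⁺+A⁻≡4b = identity a e
      where
      identity : ∀ a e → (7 * a + 2 * e) + (a + 2 * e) ≡ 4 * (2 * a + e)
      identity = solve-∀

    P+e≡2b : P + e ≡ 2 * b
    P+e≡2b = identity a e
      where
      identity : ∀ a e → (4 * a + e) + e ≡ 2 * (2 * a + e)
      identity = solve-∀

    2[b+a]+a≡A⁺ : 2 * (b + a) + a ≡ A⁺
    2[b+a]+a≡A⁺ = identity a e
      where
      identity : ∀ a e → 2 * ((2 * a + e) + a) + a ≡ 7 * a + 2 * e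
      identity = solve-∀

    d≡c+2ab : d ≡ c + 2 * a * b
    d≡c+2ab = identity a e
      where
      identity : ∀ a e → 2 * (a + 2 * e) * (4 * a + e) ≡ 2 * (7 * a + 2 * e) * e + 2 * a * (2 * a + e) + 2 * a * (2 * a + e)
      identity = solve-∀

    1≤b : 1 ≤ b
    1≤b = ≤-trans a≥1 (≤-trans (m≤n*m a 2) (m≤m+n (2 * a) e))

    1≤P : 1 ≤ P
    1≤P = ≤-trans a≥1 (≤-trans (m≤n*m a 4) (m≤m+n (4 * a) e))

    1≤2ab : 1 ≤ 2 * a * b
    1≤2ab = *-mono-≤ {1} {2 * a} (*-mono-≤ {1} {2} (s≤s (z≤n {1})) a≥1) 1≤b

    1≤c : 1 ≤ c
    1≤c = ≤-trans 1≤2ab (m≤n+m (2 * a * b) (2 * A⁺ * e))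

    c<d : c < d
    c<d = ≤-trans (≤-reflexive (+-comm 1 c)) (≤-trans (+-monoʳ-≤ c 1≤2ab) (≤-reflexive (sym d≡c+2ab)))

    -- low s x says x < (1/2 + ε/2)s, the codegree threshold of 𝒫(ε/2) on s vertices.
    low : ℕ → ℕ → Bool
    low s x = 2 * b * x <ᵇ (b + a) * s

    module _ {s n E F : ℕ}
             (s≡ : A⁻ * s ≡ 4 * b * k + E) (E-large : 8 * A⁺ * e * k + 1 ≤ E)
             (n≡ : P * n ≡ 2 * b * (s + 1) + F) (F-large : 2 * A⁺ * (A⁻ * s) * (2 * b * (e * (s + 1) + P)) < F) where

      -- E and F bound 4b(r ∸ x) and 2b(t ∸ x) from below on the whole range 4bx ≤ A⁺s; being
      -- large, they absorb the lower-order terms of ratio-inequality.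
      private
        rest = 2 * A⁺ * (A⁻ * s) * (2 * b * (e * (s + 1) + P))

        1≤E : 1 ≤ E
        1≤E = m+n≤o⇒n≤o (8 * A⁺ * e * k) E-large

        1≤F : 1 ≤ F
        1≤F = ≤-trans (s≤s z≤n) F-large

      -- The slack c - 2A⁺e = 2ab pays for the k-term and for rest, abEF each.
      ratio-inequality : d * (A⁺ * s) * (e * n + 2 * b) ≤ c * E * F
      ratio-inequality = begin
        2 * A⁻ * P * (A⁺ * s) * (e * n + 2 * b)
          ≡⟨ regroup₁ A⁺ A⁻ P s e n b ⟩
        2 * A⁺ * (A⁻ * s) * (e * (P * n) + 2 * b * P)
          ≡⟨ cong (λ m → 2 * A⁺ * (A⁻ * s) * (e * m + 2 * b * P)) n≡ ⟩
        2 * A⁺ * (A⁻ * s) * (e * (2 * b * (s + 1) + F) + 2 * b * P)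
          ≡⟨ regroup₂ A⁺ A⁻ P s e b F ⟩
        2 * A⁺ * e * (A⁻ * s) * F + rest
          ≡⟨ cong (λ m → 2 * A⁺ * e * m * F + rest) s≡ ⟩
        2 * A⁺ * e * (4 * b * k + E) * F + rest
          ≡⟨ cong (_+ rest) (regroup₃ A⁺ e b k E F) ⟩
        2 * A⁺ * e * E * F + 8 * A⁺ * e * k * (b * F) + rest
          ≤⟨ +-mono-≤ (+-monoʳ-≤ (2 * A⁺ * e * E * F) k-term) rest≤abEF ⟩
        2 * A⁺ * e * E * F + a * b * E * F + a * b * E * F
          ≡⟨ regroup₄ A⁺ e a b E F ⟩
        (2 * A⁺ * e + 2 * a * b) * E * F ∎
        where
        open ≤-Reasoning
        regroup₁ : ∀ A⁺ A⁻ P s e n b → 2 * A⁻ * P * (A⁺ * s) * (e * n + 2 * b) ≡ 2 * A⁺ * (A⁻ * s) * (e * (P * n) + 2 * b * P)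
        regroup₁ = solve-∀
        regroup₂ : ∀ A⁺ A⁻ P s e b F → 2 * A⁺ * (A⁻ * s) * (e * (2 * b * (s + 1) + F) + 2 * b * P)
                                        ≡ 2 * A⁺ * e * (A⁻ * s) * F + 2 * A⁺ * (A⁻ * s) * (2 * b * (e * (s + 1) + P))
        regroup₂ = solve-∀
        regroup₃ : ∀ A⁺ e b k E F → 2 * A⁺ * e * (4 * b * k + E) * F ≡ 2 * A⁺ * e * E * F + 8 * A⁺ * e * k * (b * F)
        regroup₃ = solve-∀
        regroup₄ : ∀ A⁺ e a b E F → 2 * A⁺ * e * E * F + a * b * E * F + a * b * E * F ≡ (2 * A⁺ * e + 2 * a * b) * E * F
        regroup₄ = solve-∀
        k-term : 8 * A⁺ * e * k * (b * F) ≤ a * b * E * F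
        k-term = begin
          8 * A⁺ * e * k * (b * F) ≤⟨ *-monoˡ-≤ (b * F) (≤-trans (m≤m+n _ 1) E-large) ⟩
          E * (b * F)             ≤⟨ *-monoˡ-≤ (b * F) (m≤n*m E a ⦃ >-nonZero a≥1 ⦄) ⟩
          a * E * (b * F)         ≡⟨ regroup a E b F ⟩
          a * b * E * F           ∎
          where
          regroup : ∀ a E b F → a * E * (b * F) ≡ a * b * E * F
          regroup = solve-∀
        rest≤abEF : rest ≤ a * b * E * F
        rest≤abEF = ≤-trans (<⇒≤ F-large) (m≤n*m F (a * b * E) ⦃ >-nonZero (*-mono-≤ (*-mono-≤ a≥1 1≤b) 1≤E) ⦄)

      module _ {w r t u : ℕ} (w≤k : w ≤ k) (r+w≡s : r + w ≡ s) (t+u≤n : t + u ≤ n) (Pn≤2b[t+1] : P * n ≤ 2 * b * (t + 1)) where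

        private
          4b = 4 * b

          1≤4b : 1 ≤ 4b
          1≤4b = ≤-trans 1≤b (m≤n*m b 4)

          x≤s : ∀ {x} → 4b * x ≤ A⁺ * s → x ≤ s
          x≤s {x} 4bx≤A⁺s = *-cancelˡ-≤ 4b ⦃ >-nonZero 1≤4b ⦄ (≤-trans 4bx≤A⁺s (*-monoˡ-≤ s (≤-trans (m≤m+n A⁺ A⁻) (≤-reflexive A⁺+A⁻≡4b))))

          E≤4b[r∸x] : ∀ {x} → 4b * x ≤ A⁺ * s → E ≤ 4b * (r ∸ x)
          E≤4b[r∸x] {x} 4bx≤A⁺s = subst (E ≤_) (sym (*-distribˡ-∸ 4b r x)) (m+n≤o⇒m≤o∸n E (+-cancelʳ-≤ (4b * w) _ _ (begin
            E + 4b * x + 4b * w   ≤⟨ +-mono-≤ (+-monoʳ-≤ E 4bx≤A⁺s) (*-monoʳ-≤ 4b w≤k) ⟩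
            E + A⁺ * s + 4b * k   ≡⟨ regroup E (A⁺ * s) (4b * k) ⟩
            A⁺ * s + (4b * k + E) ≡⟨ cong (A⁺ * s +_) (sym s≡) ⟩
            A⁺ * s + A⁻ * s       ≡⟨ sym (*-distribʳ-+ s A⁺ A⁻) ⟩
            (A⁺ + A⁻) * s         ≡⟨ cong (_* s) A⁺+A⁻≡4b ⟩
            4b * s                ≡⟨ cong (4b *_) (sym r+w≡s) ⟩
            4b * (r + w)          ≡⟨ *-distribˡ-+ 4b r w ⟩
            4b * r + 4b * w       ∎)))
            where
            open ≤-Reasoning
            regroup : ∀ x y z → x + y + z ≡ y + (z + x)
            regroup = solve-∀

          F≤2b[t∸x] : ∀ {x} → x ≤ s → F ≤ 2 * b * (t ∸ x)
          F≤2b[t∸x] {x} x≤s′ = subst (F ≤_) (sym (*-distribˡ-∸ (2 * b) t x)) (m+n≤o⇒m≤o∸n F (+-cancelʳ-≤ (2 * b) _ _ (begin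
            F + 2 * b * x + 2 * b       ≤⟨ +-monoˡ-≤ (2 * b) (+-monoʳ-≤ F (*-monoʳ-≤ (2 * b) x≤s′)) ⟩
            F + 2 * b * s + 2 * b       ≡⟨ regroup F (2 * b) s ⟩
            2 * b * (s + 1) + F         ≡⟨ sym n≡ ⟩
            P * n                       ≤⟨ Pn≤2b[t+1] ⟩
            2 * b * (t + 1)             ≡⟨ trans (*-distribˡ-+ (2 * b) t 1) (cong (2 * b * t +_) (*-identityʳ (2 * b))) ⟩
            2 * b * t + 2 * b           ∎)))
            where
            open ≤-Reasoning
            regroup : ∀ F y s → F + y * s + y ≡ y * (s + 1) + F
            regroup = solve-∀

          2bu≤en+2b : 2 * b * u ≤ e * n + 2 * b
          2bu≤en+2b = +-cancelˡ-≤ (P * n) _ _ (begin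
            P * n + 2 * b * u             ≤⟨ +-monoˡ-≤ (2 * b * u) Pn≤2b[t+1] ⟩
            2 * b * (t + 1) + 2 * b * u   ≡⟨ regroup (2 * b) t u ⟩
            2 * b * (t + u) + 2 * b       ≤⟨ +-monoˡ-≤ (2 * b) (*-monoʳ-≤ (2 * b) t+u≤n) ⟩
            2 * b * n + 2 * b             ≡⟨ cong (λ m → m * n + 2 * b) (sym P+e≡2b) ⟩
            (P + e) * n + 2 * b           ≡⟨ trans (cong (_+ 2 * b) (*-distribʳ-+ n P e)) (+-assoc (P * n) (e * n) (2 * b)) ⟩
            P * n + (e * n + 2 * b)       ∎)
            where
            open ≤-Reasoning
            regroup : ∀ y t u → y * (t + 1) + y * u ≡ y * (t + u) + y
            regroup = solve-∀

          ratio-bound : ∀ {x} → 4b * x ≤ A⁺ * s → d * x * u ≤ c * ((t ∸ x) * (r ∸ x))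
          ratio-bound {x} 4bx≤A⁺s =
            product-bound {c} {d} {x} {u} {r ∸ x} {t ∸ x} {E} {F} {A⁺ * s} {e * n + 2 * b}
              (scale-bound {x} {r ∸ x} {4b} (E≤4b[r∸x] 4bx≤A⁺s) 4bx≤A⁺s)
              (scale-bound {u} {t ∸ x} {2 * b} (F≤2b[t∸x] (x≤s 4bx≤A⁺s)) 2bu≤en+2b)
              ratio-inequality (*-mono-≤ 1≤E 1≤F)

        consecutive-ratio : ∀ j → 4 * b * suc j ≤ A⁺ * s →
          j < r × 0 < (t ∸ j) * (r ∸ j) × d * (suc j * (u ∸ (r ∸ suc j))) ≤ c * ((t ∸ j) * (r ∸ j))
        consecutive-ratio j bound = j<r , *-mono-≤ 0<t∸j 0<r∸j , (begin
          d * (suc j * (u ∸ (r ∸ suc j))) ≤⟨ *-monoʳ-≤ d (*-monoʳ-≤ (suc j) (m∸n≤m u (r ∸ suc j))) ⟩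
          d * (suc j * u)                 ≡⟨ sym (*-assoc d (suc j) u) ⟩
          d * suc j * u                   ≤⟨ ratio-bound bound ⟩
          c * ((t ∸ suc j) * (r ∸ suc j)) ≤⟨ *-monoʳ-≤ c (*-mono-≤ (∸-monoʳ-≤ t (n≤1+n j)) (∸-monoʳ-≤ r (n≤1+n j))) ⟩
          c * ((t ∸ j) * (r ∸ j))         ∎)
          where
          open ≤-Reasoning
          0<r∸1+j : 0 < r ∸ suc j
          0<r∸1+j = 1≤q*x⇒0<x {4b} (≤-trans 1≤E (E≤4b[r∸x] bound))
          0<t∸1+j : 0 < t ∸ suc j
          0<t∸1+j = 1≤q*x⇒0<x {2 * b} (≤-trans 1≤F (F≤2b[t∸x] (x≤s bound)))
          j<r : j < r
          j<r = <-trans (n<1+n j) (m∸n≢0⇒n<m (>⇒≢ 0<r∸1+j))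
          0<t∸j : 0 < t ∸ j
          0<t∸j = ≤-trans 0<t∸1+j (∸-monoʳ-≤ t (n≤1+n j))
          0<r∸j : 0 < r ∸ j
          0<r∸j = ≤-trans 0<r∸1+j (∸-monoʳ-≤ r (n≤1+n j))

      module _ (W Y : Subset n) (W∩Y≡⊥ : W ∩ Y ≡ ⊥) (∣W∣≤k : ∣ W ∣ ≤ k) (Pn≤2b[t+1] : P * n ≤ 2 * b * (∣ Y ∣ + 1)) where

        private
          t = ∣ Y ∣
          u = ∣ ∁ (W ∪ Y) ∣
          w = ∣ W ∣
          r = s ∸ w

          fits : ∀ {y} → 4 * b * y ≤ A⁺ * s → y + w ≤ s
          fits {y} 4by≤A⁺s = *-cancelˡ-≤ (4 * b) ⦃ >-nonZero (≤-trans 1≤b (m≤n*m b 4)) ⦄ (begin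
            4 * b * (y + w)         ≡⟨ *-distribˡ-+ (4 * b) y w ⟩
            4 * b * y + 4 * b * w   ≤⟨ +-mono-≤ 4by≤A⁺s (*-monoʳ-≤ (4 * b) ∣W∣≤k) ⟩
            A⁺ * s + 4 * b * k      ≤⟨ +-monoʳ-≤ (A⁺ * s) (≤-trans (m≤m+n (4 * b * k) E) (≤-reflexive (sym s≡))) ⟩
            A⁺ * s + A⁻ * s         ≡⟨ trans (sym (*-distribʳ-+ s A⁺ A⁻)) (cong (_* s) A⁺+A⁻≡4b) ⟩
            4 * b * s               ∎)
            where open ≤-Reasoning

          r+w≡s : r + w ≡ s
          r+w≡s = m∸n+n≡m (≤-trans (m≤n+m w 0) (fits (≤-trans (≤-reflexive (*-zeroʳ (4 * b))) z≤n)))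

        count-at : ℕ → ℕ
        count-at i = countˢ (λ S → W ⊆ᵇ S ∧ (∣ Y ∩ S ∣ ≡ᵇ i) ∧ (∣ S ∣ ≡ᵇ s))

        count-at≡hypergeometric : ∀ {i} → 4 * b * i ≤ A⁺ * s → count-at i ≡ hypergeometric t u r i
        count-at≡hypergeometric {i} 4bi≤A⁺s =
          trans (countˢ-cong (λ S → cong (λ m → W ⊆ᵇ S ∧ (∣ Y ∩ S ∣ ≡ᵇ i) ∧ (∣ S ∣ ≡ᵇ m)) (sym w+i+[r∸i]≡s)))
                (count-hypergeometric W Y W∩Y≡⊥ i (r ∸ i))
          where
          i≤r : i ≤ r
          i≤r = m+n≤o⇒m≤o∸n i (fits 4bi≤A⁺s)
          w+i+[r∸i]≡s : w + i + (r ∸ i) ≡ s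
          w+i+[r∸i]≡s = trans (+-assoc w i (r ∸ i)) (trans (cong (w +_) (m+[n∸m]≡n i≤r)) (trans (+-comm w r) r+w≡s))

        low-count-decays : ∀ L → 4 * b * L ≤ a * s → ∀ i → T (low s i) → d ^ L * count-at i ≤ c ^ L * count-at (i + L)
        low-count-decays L 4bL≤as i low-i = begin
          d ^ L * count-at i                   ≡⟨ cong (d ^ L *_) (count-at≡hypergeometric (m+n≤o⇒m≤o (4 * b * i) 4bi+4bL≤A⁺s)) ⟩
          d ^ L * hypergeometric t u r i       ≤⟨ geometric-chain (hypergeometric t u r) c d i L step ⟩
          c ^ L * hypergeometric t u r (i + L) ≡⟨ cong (c ^ L *_) (sym (count-at≡hypergeometric 4b[i+L]≤A⁺s)) ⟩
          c ^ L * count-at (i + L)             ∎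
          where
          open ≤-Reasoning
          4bi+4bL≤A⁺s : 4 * b * i + 4 * b * L ≤ A⁺ * s
          4bi+4bL≤A⁺s = begin
            4 * b * i + 4 * b * L       ≡⟨ cong (_+ 4 * b * L) (regroup b i) ⟩
            2 * (2 * b * i) + 4 * b * L ≤⟨ +-mono-≤ (*-monoʳ-≤ 2 (<⇒≤ (<ᵇ⇒< (2 * b * i) ((b + a) * s) low-i))) 4bL≤as ⟩
            2 * ((b + a) * s) + a * s   ≡⟨ trans (cong (_+ a * s) (sym (*-assoc 2 (b + a) s))) (sym (*-distribʳ-+ s (2 * (b + a)) a)) ⟩
            (2 * (b + a) + a) * s       ≡⟨ cong (_* s) 2[b+a]+a≡A⁺ ⟩
            A⁺ * s                      ∎
            where
            regroup : ∀ b i → 4 * b * i ≡ 2 * (2 * b * i)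
            regroup = solve-∀
          4b[i+L]≤A⁺s : 4 * b * (i + L) ≤ A⁺ * s
          4b[i+L]≤A⁺s = ≤-trans (≤-reflexive (*-distribˡ-+ (4 * b) i L)) 4bi+4bL≤A⁺s
          step : ∀ m → m < L → d * hypergeometric t u r (i + m) ≤ c * hypergeometric t u r (suc (i + m))
          step m m<L = let j<r , pos , ratio≤ = consecutive-ratio ∣W∣≤k r+w≡s (∣q∣+∣∁[p∪q]∣≤n W Y) Pn≤2b[t+1] (i + m) in-range in
                       hypergeometric-step c d t u r (i + m) j<r pos ratio≤
            where
            in-range : 4 * b * suc (i + m) ≤ A⁺ * s
            in-range = ≤-trans (*-monoʳ-≤ (4 * b) (≤-trans (≤-reflexive (sym (+-suc i m))) (+-monoʳ-≤ i m<L))) 4b[i+L]≤A⁺s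

        tail-bound : ∀ L → 4 * b * L ≤ a * s →
          d ^ L * countˢ (λ S → W ⊆ᵇ S ∧ low s ∣ Y ∩ S ∣ ∧ (∣ S ∣ ≡ᵇ s)) ≤ suc s * (c ^ L * countˢ (λ S → W ⊆ᵇ S ∧ (∣ S ∣ ≡ᵇ s)))
        tail-bound L 4bL≤as = begin
          d ^ L * countˢ (λ S → W ⊆ᵇ S ∧ low s ∣ Y ∩ S ∣ ∧ (∣ S ∣ ≡ᵇ s))
            ≤⟨ *-monoʳ-≤ (d ^ L) (countˢ-by-value (suc s) (W ⊆ᵇ_) (λ S → ∣ S ∣ ≡ᵇ s) (λ S → ∣ Y ∩ S ∣) (low s) ∣Y∩S∣<1+s) ⟩
          d ^ L * sum< (suc s) (λ i → χ (low s i) * count-at i)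
            ≡⟨ sym (sum<-*ˡ (suc s) (d ^ L) (λ i → χ (low s i) * count-at i)) ⟩
          sum< (suc s) (λ i → d ^ L * (χ (low s i) * count-at i))
            ≤⟨ sum<-mono-≤ (suc s) low-values ⟩
          sum< (suc s) (λ _ → c ^ L * total)
            ≡⟨ sum<-const (suc s) (c ^ L * total) ⟩
          suc s * (c ^ L * total) ∎
          where
          open ≤-Reasoning
          total = countˢ (λ S → W ⊆ᵇ S ∧ (∣ S ∣ ≡ᵇ s))
          forget-size : ∀ {j} S → T (W ⊆ᵇ S ∧ (∣ Y ∩ S ∣ ≡ᵇ j) ∧ (∣ S ∣ ≡ᵇ s)) → T (W ⊆ᵇ S ∧ (∣ S ∣ ≡ᵇ s))
          forget-size S chosen = let W⊆S , _ , ∣S∣≡s = T-∧⁻₃ {W ⊆ᵇ S} chosen in T-∧⁺ W⊆S ∣S∣≡s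
          ∣Y∩S∣<1+s : ∀ S → T (W ⊆ᵇ S) → T (∣ S ∣ ≡ᵇ s) → ∣ Y ∩ S ∣ < suc s
          ∣Y∩S∣<1+s S _ ∣S∣≡s = s≤s (≤-trans (∣p∩q∣≤∣q∣ Y S) (≤-reflexive (≡ᵇ⇒≡ ∣ S ∣ s ∣S∣≡s)))
          low-values : ∀ i → d ^ L * (χ (low s i) * count-at i) ≤ c ^ L * total
          low-values i with low s i in low-i
          ... | false = ≤-trans (≤-reflexive (*-zeroʳ (d ^ L))) z≤n
          ... | true  = begin
            d ^ L * (1 * count-at i)  ≡⟨ cong (d ^ L *_) (*-identityˡ (count-at i)) ⟩
            d ^ L * count-at i        ≤⟨ low-count-decays L 4bL≤as i (subst T (sym low-i) _) ⟩
            c ^ L * count-at (i + L)  ≤⟨ *-monoʳ-≤ (c ^ L) (countˢ-mono {n} forget-size) ⟩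
            c ^ L * total             ∎

  -- Exponential versus polynomial growth

  bernoulli : ∀ c m → c ^ m * (c + m) ≤ (c + 1) ^ m * c
  bernoulli c zero    = ≤-reflexive (cong (λ x → x + 0 * x) (+-identityʳ c))
  bernoulli c (suc m) = begin
    c * c ^ m * (c + suc m)                ≤⟨ m≤m+n _ (c ^ m * m) ⟩
    c * c ^ m * (c + suc m) + c ^ m * m    ≡⟨ regroup₁ c (c ^ m) m ⟩
    c ^ m * (c + m) * (c + 1)              ≤⟨ *-monoˡ-≤ (c + 1) (bernoulli c m) ⟩
    (c + 1) ^ m * c * (c + 1)              ≡⟨ regroup₂ (c + 1) ((c + 1) ^ m) c ⟩
    (c + 1) * (c + 1) ^ m * c              ∎
    where
    open ≤-Reasoning
    regroup₁ : ∀ c x m → c * x * (c + suc m) + x * m ≡ x * (c + m) * (c + 1)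
    regroup₁ = solve-∀
    regroup₂ : ∀ y x c → x * c * y ≡ y * x * c
    regroup₂ = solve-∀

  [m*n]^o≡m^o*n^o : ∀ m n o → (m * n) ^ o ≡ m ^ o * n ^ o
  [m*n]^o≡m^o*n^o m n zero    = refl
  [m*n]^o≡m^o*n^o m n (suc o) = trans (cong (m * n *_) ([m*n]^o≡m^o*n^o m n o)) (regroup m n (m ^ o) (n ^ o))
    where
    regroup : ∀ m n x y → m * n * (x * y) ≡ m * x * (n * y)
    regroup = solve-∀

  2^m*c^[cm]≤d^[cm] : ∀ c d m → 1 ≤ c → c < d → 2 ^ m * c ^ (c * m) ≤ d ^ (c * m)
  2^m*c^[cm]≤d^[cm] c d m c≥1 c<d = begin
    2 ^ m * c ^ (c * m)  ≡⟨ cong (2 ^ m *_) (sym (^-*-assoc c c m)) ⟩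
    2 ^ m * (c ^ c) ^ m  ≡⟨ sym ([m*n]^o≡m^o*n^o 2 (c ^ c) m) ⟩
    (2 * c ^ c) ^ m      ≤⟨ ^-monoˡ-≤ m 2c^c≤[c+1]^c ⟩
    ((c + 1) ^ c) ^ m    ≤⟨ ^-monoˡ-≤ m (^-monoˡ-≤ c (≤-trans (≤-reflexive (+-comm c 1)) c<d)) ⟩
    (d ^ c) ^ m          ≡⟨ ^-*-assoc d c m ⟩
    d ^ (c * m)          ∎
    where
    open ≤-Reasoning
    2c^c≤[c+1]^c : 2 * c ^ c ≤ (c + 1) ^ c
    2c^c≤[c+1]^c = *-cancelʳ-≤ (2 * c ^ c) ((c + 1) ^ c) c ⦃ >-nonZero c≥1 ⦄
      (≤-trans (≤-reflexive (regroup c (c ^ c))) (bernoulli c c))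
      where
      regroup : ∀ c x → 2 * x * c ≡ x * (c + c)
      regroup = solve-∀

  n*n≤2^n : ∀ n → 4 ≤ n → n * n ≤ 2 ^ n
  n*n≤2^n n 4≤n with m≤n⇒∃[o]m+o≡n 4≤n
  ... | t , refl = 4+t-squared t
    where
    4+t-squared : ∀ t → (4 + t) * (4 + t) ≤ 2 ^ (4 + t)
    4+t-squared zero    = ≤-refl
    4+t-squared (suc t) = begin
      (5 + t) * (5 + t)                         ≡⟨ regroup₁ t ⟩
      (4 + t) * (4 + t) + (9 + 2 * t)           ≤⟨ +-monoʳ-≤ ((4 + t) * (4 + t)) (≤-trans (m≤m+n (9 + 2 * t) (7 + 6 * t + t * t)) (≤-reflexive (regroup₂ t))) ⟩
      (4 + t) * (4 + t) + (4 + t) * (4 + t)     ≤⟨ +-mono-≤ (4+t-squared t) (≤-trans (4+t-squared t) (m≤m+n _ 0)) ⟩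
      2 ^ (4 + t) + (2 ^ (4 + t) + 0)           ∎
      where
      open ≤-Reasoning
      regroup₁ : ∀ t → (5 + t) * (5 + t) ≡ (4 + t) * (4 + t) + (9 + 2 * t)
      regroup₁ = solve-∀
      regroup₂ : ∀ t → 9 + 2 * t + (7 + 6 * t + t * t) ≡ (4 + t) * (4 + t)
      regroup₂ = solve-∀

  1+s≤2^[s/G] : ∀ G s .⦃ _ : NonZero G ⦄ → G * (2 * G + 4) ≤ s → suc s ≤ 2 ^ (s / G)
  1+s≤2^[s/G] G s G[2G+4]≤s = begin
    suc s                 ≡⟨ cong suc (m≡m%n+[m/n]*n s G) ⟩
    suc (s % G + z * G)   ≤⟨ +-monoˡ-≤ (z * G) (m%n<n s G) ⟩
    G + z * G             ≡⟨ regroup₁ G z ⟩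
    G * (z + 1)           ≤⟨ *-monoʳ-≤ G (+-monoʳ-≤ z 1≤z) ⟩
    G * (z + z)           ≡⟨ regroup₂ G z ⟩
    (2 * G) * z           ≤⟨ *-monoˡ-≤ z (≤-trans (m≤m+n (2 * G) 4) 2G+4≤z) ⟩
    z * z                 ≤⟨ n*n≤2^n z (≤-trans (m≤n+m 4 (2 * G)) 2G+4≤z) ⟩
    2 ^ z                 ∎
    where
    open ≤-Reasoning
    z = s / G
    2G+4≤z : 2 * G + 4 ≤ z
    2G+4≤z = ≤-trans (≤-reflexive (sym (m*n/n≡m (2 * G + 4) G))) (/-monoˡ-≤ G (≤-trans (≤-reflexive (*-comm (2 * G + 4) G)) G[2G+4]≤s))
    1≤z : 1 ≤ z
    1≤z = ≤-trans (s≤s z≤n) (≤-trans (m≤n+m 4 (2 * G)) 2G+4≤z)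
    regroup₁ : ∀ G z → G + z * G ≡ G * (z + 1)
    regroup₁ = solve-∀
    regroup₂ : ∀ G z → G * (z + z) ≡ (2 * G) * z
    regroup₂ = solve-∀

  polynomial≤exponential : ∀ c d k s z → 1 ≤ c → c < d → suc s ≤ 2 ^ z →
    s * s * suc s ^ (k + 1) * c ^ (c * ((k + 3) * z)) ≤ d ^ (c * ((k + 3) * z))
  polynomial≤exponential c d k s z c≥1 c<d 1+s≤2^z = begin
    s * s * suc s ^ (k + 1) * c ^ (c * m) ≤⟨ *-monoˡ-≤ (c ^ (c * m)) s²[1+s]^[k+1]≤2^m ⟩
    2 ^ m * c ^ (c * m)                   ≤⟨ 2^m*c^[cm]≤d^[cm] c d m c≥1 c<d ⟩
    d ^ (c * m)                           ∎
    where
    open ≤-Reasoning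
    m = (k + 3) * z
    s²[1+s]^[k+1]≤2^m : s * s * suc s ^ (k + 1) ≤ 2 ^ m
    s²[1+s]^[k+1]≤2^m = begin
      s * s * suc s ^ (k + 1)             ≤⟨ *-monoˡ-≤ (suc s ^ (k + 1)) (*-mono-≤ (n≤1+n s) (n≤1+n s)) ⟩
      suc s * suc s * suc s ^ (k + 1)     ≡⟨ trans (*-assoc (suc s) (suc s) _) (cong (suc s ^_) (exponent k)) ⟩
      suc s ^ (k + 3)                     ≤⟨ ^-monoˡ-≤ (k + 3) 1+s≤2^z ⟩
      (2 ^ z) ^ (k + 3)                   ≡⟨ trans (^-*-assoc 2 z (k + 3)) (cong (2 ^_) (*-comm z (k + 3))) ⟩
      2 ^ m                               ∎
      where
      exponent : ∀ k → 2 + (k + 1) ≡ k + 3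
      exponent = solve-∀

  -- Counting bad sets

  module BadSets {k n : ℕ} (H : KGraph k n) (k≥1 : 1 ≤ k) (a e : ℕ) (a≥1 : 1 ≤ a) (v : Fin n) where
    open Tail a e k a≥1

    small : Subset n → Bool
    small B = (∣ B ∣ <ᵇ k) ∧ inEdgeᵇ H B

    module _ (s : ℕ) where

      base : Subset n → Bool
      base S = (∣ S ∣ ≡ᵇ s) ∧ lookup S v

      bad-via : Subset n → Subset n → Bool
      bad-via B S = small B ∧ B ⊆ᵇ S ∧ low s ∣ extensions H v B ∩ S ∣

      bad : Subset n → Bool
      bad S = anyˢ (λ B → bad-via B S)

      not-bad : ∀ {S} → ¬ T (bad S) → ∀ {B} → B ⊆ S → ∣ B ∣ < k → InEdge H B → (b + a) * s ≤ 2 * b * ∣ extensions H v B ∩ S ∣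
      not-bad ¬bad {B} B⊆S ∣B∣<k inB = ≮⇒≥ λ few →
        ¬bad (anyˢ⁺ B (T-∧⁺ (T-∧⁺ (<⇒<ᵇ ∣B∣<k) (InEdge⇒inEdgeᵇ H inB)) (T-∧⁺ (⊆⇒⊆ᵇ B⊆S) (<⇒<ᵇ few))))

      union-bound : countˢ (λ S → base S ∧ bad S) ≤ sumˢ (λ B → countˢ (λ S → base S ∧ bad-via B S))
      union-bound = begin
        sumˢ (λ S → χ (base S ∧ bad S))                    ≤⟨ sumˢ-mono-≤ pointwise ⟩
        sumˢ (λ S → sumˢ (λ B → χ (base S ∧ bad-via B S))) ≡⟨ sumˢ-comm (λ S B → χ (base S ∧ bad-via B S)) ⟩
        sumˢ (λ B → countˢ (λ S → base S ∧ bad-via B S))   ∎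
        where
        open ≤-Reasoning
        pointwise : ∀ S → χ (base S ∧ bad S) ≤ sumˢ (λ B → χ (base S ∧ bad-via B S))
        pointwise S with base S ∧ bad S in base∧bad
        ... | false = z≤n
        ... | true  = let baseS , badS = T-∧⁻ {base S} (subst T (sym base∧bad) _) ; B , via = anyˢ⁻ badS in
          ≤-trans (≤-reflexive (sym (cong χ (T⇒≡true (T-∧⁺ baseS via))))) (term≤sumˢ (λ B → χ (base S ∧ bad-via B S)) B)

      small-subsets-bound : sumˢ (λ B → countˢ (λ S → base S ∧ B ⊆ᵇ S ∧ (∣ B ∣ <ᵇ k))) ≤ suc s ^ k * countˢ base
      small-subsets-bound = begin
        sumˢ (λ B → sumˢ (λ S → χ (base S ∧ B ⊆ᵇ S ∧ (∣ B ∣ <ᵇ k))))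
          ≡⟨ sumˢ-comm (λ B S → χ (base S ∧ B ⊆ᵇ S ∧ (∣ B ∣ <ᵇ k))) ⟩
        sumˢ (λ S → countˢ (λ B → base S ∧ B ⊆ᵇ S ∧ (∣ B ∣ <ᵇ k)))
          ≤⟨ sumˢ-mono-≤ pointwise ⟩
        sumˢ (λ S → suc s ^ k * χ (base S))
          ≡⟨ sumˢ-*ˡ (suc s ^ k) (χ ∘ base) ⟩
        suc s ^ k * countˢ base ∎
        where
        open ≤-Reasoning
        pointwise : ∀ S → countˢ (λ B → base S ∧ B ⊆ᵇ S ∧ (∣ B ∣ <ᵇ k)) ≤ suc s ^ k * χ (base S)
        pointwise S with base S in baseS
        ... | false = ≤-reflexive (trans (countˢ-none {n} λ _ → refl) (sym (*-zeroʳ (suc s ^ k))))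
        ... | true  = ≤-trans (count-⊆-smaller S k) (≤-reflexive (trans (cong (λ m → suc m ^ k) ∣S∣≡s) (sym (*-identityʳ (suc s ^ k)))))
          where
          ∣S∣≡s : ∣ S ∣ ≡ s
          ∣S∣≡s = ≡ᵇ⇒≡ ∣ S ∣ s (proj₁ (T-∧⁻ (subst T (sym baseS) _)))

    module _ (dense : ∀ {A} → ∣ A ∣ ≡ k ∸ 1 → 0 < codeg H ⊤ A → P * n ≤ 2 * b * codeg H ⊤ A) where

      extensions-large : ∀ {B} → T (small B) → P * n ≤ 2 * b * (∣ extensions H v B ∣ + 1)
      extensions-large {B} small-B with T-∧⁻ {∣ B ∣ <ᵇ k} small-B
      ... | ∣B∣<k , inB with inEdgeᵇ⇒InEdge H inB
      ... | E , edgeE , B⊆E with ∃-⊆-between (k ∸ 1) B⊆E (m+n≤o⇒m≤o∸n ∣ B ∣ (≤-trans (≤-reflexive (+-comm ∣ B ∣ 1)) (<ᵇ⇒< ∣ B ∣ k ∣B∣<k)))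
                                                       (≤-trans (m∸n≤m k 1) (≤-reflexive (sym (uniform H E edgeE))))
      ... | A , B⊆A , A⊆E , ∣A∣≡ = begin
        P * n                       ≤⟨ dense ∣A∣≡ (edge⇒codeg>0 H edgeE (⊆⊤ {p = E}) A⊆E) ⟩
        2 * b * codeg H ⊤ A         ≡⟨ cong (2 * b *_) (codeg≡∣nbhd∣ H k≥1 ⊤ A ∣A∣≡) ⟩
        2 * b * ∣ nbhd H ⊤ A ∣       ≤⟨ *-monoʳ-≤ (2 * b) (∣nbhd∣≤∣extensions∣+1 H v B⊆A) ⟩
        2 * b * (∣ extensions H v B ∣ + 1) ∎
        where open ≤-Reasoning

      module _ {s E F : ℕ}
               (s≡ : A⁻ * s ≡ 4 * b * k + E) (E-large : 8 * A⁺ * e * k + 1 ≤ E)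
               (n≡ : P * n ≡ 2 * b * (s + 1) + F) (F-large : 2 * A⁺ * (A⁻ * s) * (2 * b * (e * (s + 1) + P)) < F)
               (L : ℕ) (4bL≤as : 4 * b * L ≤ a * s) where

        bad-via-bound : ∀ B → d ^ L * countˢ (λ S → base s S ∧ bad-via s B S) ≤ suc s * (c ^ L * countˢ (λ S → base s S ∧ B ⊆ᵇ S ∧ (∣ B ∣ <ᵇ k)))
        bad-via-bound B with small B in small-B
        ... | false = ≤-trans (≤-reflexive (trans (cong (d ^ L *_) (countˢ-none λ S → ∧-zeroʳ (base s S))) (*-zeroʳ (d ^ L)))) z≤n
        ... | true  = begin
          d ^ L * countˢ (λ S → base s S ∧ B ⊆ᵇ S ∧ low s ∣ Y ∩ S ∣)
            ≤⟨ *-monoʳ-≤ (d ^ L) (countˢ-mono {n} bad⇒low) ⟩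
          d ^ L * countˢ (λ S → W ⊆ᵇ S ∧ low s ∣ Y ∩ S ∣ ∧ (∣ S ∣ ≡ᵇ s))
            ≤⟨ tail-bound s≡ E-large n≡ F-large W Y (extensions-disjoint H v B) ∣W∣≤k (extensions-large B-small) L 4bL≤as ⟩
          suc s * (c ^ L * countˢ (λ S → W ⊆ᵇ S ∧ (∣ S ∣ ≡ᵇ s)))
            ≤⟨ *-monoʳ-≤ (suc s) (*-monoʳ-≤ (c ^ L) (countˢ-mono {n} ⊇W⇒small-subset)) ⟩
          suc s * (c ^ L * countˢ (λ S → base s S ∧ B ⊆ᵇ S ∧ (∣ B ∣ <ᵇ k))) ∎
          where
          open ≤-Reasoning
          W = B ∪ ⁅ v ⁆
          Y = extensions H v B
          B-small : T (small B)
          B-small = subst T (sym small-B) _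
          ∣B∣<k : T (∣ B ∣ <ᵇ k)
          ∣B∣<k = proj₁ (T-∧⁻ {∣ B ∣ <ᵇ k} B-small)
          ∣W∣≤k : ∣ W ∣ ≤ k
          ∣W∣≤k = ≤-trans (∣p∪⁅x⁆∣≤1+∣p∣ B v) (<ᵇ⇒< ∣ B ∣ k ∣B∣<k)
          bad⇒low : ∀ S → T (base s S ∧ B ⊆ᵇ S ∧ low s ∣ Y ∩ S ∣) → T (W ⊆ᵇ S ∧ low s ∣ Y ∩ S ∣ ∧ (∣ S ∣ ≡ᵇ s))
          bad⇒low S chosen with T-∧⁻₃ {base s S} chosen
          ... | baseS , B⊆S , lowS with T-∧⁻ {∣ S ∣ ≡ᵇ s} baseS
          ... | ∣S∣≡s , v∈S = T-∧⁺ (⊆⇒⊆ᵇ {p = W} (∪⁅⁆⊆ (⊆ᵇ⇒⊆ {p = B} B⊆S) (T-lookup⇒∈ v∈S))) (T-∧⁺ lowS ∣S∣≡s)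
          ⊇W⇒small-subset : ∀ S → T (W ⊆ᵇ S ∧ (∣ S ∣ ≡ᵇ s)) → T (base s S ∧ B ⊆ᵇ S ∧ (∣ B ∣ <ᵇ k))
          ⊇W⇒small-subset S chosen with T-∧⁻ {W ⊆ᵇ S} chosen
          ... | W⊆ᵇS , ∣S∣≡s = T-∧⁺ (T-∧⁺ ∣S∣≡s (∈⇒T-lookup (W⊆S (q⊆p∪q B ⁅ v ⁆ (x∈⁅x⁆ v)))))
                                    (T-∧⁺ (⊆⇒⊆ᵇ (⊆-trans (p⊆p∪q ⁅ v ⁆) W⊆S)) ∣B∣<k)
            where
            W⊆S : W ⊆ S
            W⊆S = ⊆ᵇ⇒⊆ W⊆ᵇS

        few-bad : s * s * suc s ^ (k + 1) * c ^ L ≤ d ^ L → s * s * countˢ (λ S → base s S ∧ bad s S) ≤ countˢ (base s)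
        few-bad poly≤exp = *-cancelˡ-≤ (d ^ L) ⦃ m^n≢0 d L ⦃ >-nonZero (≤-trans (s≤s z≤n) c<d) ⦄ ⦄ (begin
          d ^ L * (s * s * X)                           ≡⟨ x∙yz≈y∙xz (d ^ L) (s * s) X ⟩
          s * s * (d ^ L * X)                           ≤⟨ *-monoʳ-≤ (s * s) dᴸX≤ ⟩
          s * s * (suc s * (c ^ L * (suc s ^ k * N)))   ≡⟨ regroup (s * s) (suc s) (c ^ L) (suc s ^ k) N ⟩
          s * s * (suc s * suc s ^ k) * c ^ L * N       ≡⟨ cong (λ m → s * s * m * c ^ L * N) (cong (suc s ^_) (+-comm 1 k)) ⟩
          s * s * suc s ^ (k + 1) * c ^ L * N           ≤⟨ *-monoˡ-≤ N poly≤exp ⟩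
          d ^ L * N                                     ∎)
          where
          open ≤-Reasoning
          X = countˢ (λ S → base s S ∧ bad s S)
          N = countˢ (base s)
          regroup : ∀ p q r t u → p * (q * (r * (t * u))) ≡ p * (q * t) * r * u
          regroup = solve-∀
          small-count : Subset n → ℕ
          small-count B = countˢ (λ S → base s S ∧ B ⊆ᵇ S ∧ (∣ B ∣ <ᵇ k))
          dᴸX≤ : d ^ L * X ≤ suc s * (c ^ L * (suc s ^ k * N))
          dᴸX≤ = begin
            d ^ L * X                                                       ≤⟨ *-monoʳ-≤ (d ^ L) (union-bound s) ⟩
            d ^ L * sumˢ (λ B → countˢ (λ S → base s S ∧ bad-via s B S))    ≡⟨ sym (sumˢ-*ˡ (d ^ L) (λ B → countˢ (λ S → base s S ∧ bad-via s B S))) ⟩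
            sumˢ (λ B → d ^ L * countˢ (λ S → base s S ∧ bad-via s B S))    ≤⟨ sumˢ-mono-≤ bad-via-bound ⟩
            sumˢ (λ B → suc s * (c ^ L * small-count B))
              ≡⟨ trans (sumˢ-*ˡ (suc s) (λ B → c ^ L * small-count B)) (cong (suc s *_) (sumˢ-*ˡ (c ^ L) small-count)) ⟩
            suc s * (c ^ L * sumˢ small-count)                              ≤⟨ *-monoʳ-≤ (suc s) (*-monoʳ-≤ (c ^ L) (small-subsets-bound s)) ⟩
            suc s * (c ^ L * (suc s ^ k * N))                               ∎

module Rational where

  open import Data.Integer as ℤ using (+_; +≤+)
  import Data.Integer.Properties as ℤ
  open import Data.Rational
  open import Data.Rational.Properties
  open import Data.Rational.Unnormalised as ℚᵘ using (mkℚᵘ; *≡*; *≤*) renaming (_≃_ to _≃ᵘ_)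
  import Data.Rational.Unnormalised.Properties as ℚᵘ
  open import Data.Rational.Solver using (module +-*-Solver)
  open import Data.Nat as ℕ using (suc)
  import Data.Nat.Properties as ℕ
  open import Relation.Binary.PropositionalEquality
  open +-*-Solver using (solve; _:=_; _:+_; _:*_; :-_; _:-_; con)

  toℚᵘ-ℕ→ℚ : ∀ m → toℚᵘ (ℕ→ℚ m) ≃ᵘ mkℚᵘ (+ m) 0
  toℚᵘ-ℕ→ℚ m = toℚᵘ-fromℚᵘ (mkℚᵘ (+ m) 0)

  ℕ→ℚ-+ : ∀ m n → ℕ→ℚ (m ℕ.+ n) ≡ ℕ→ℚ m + ℕ→ℚ n
  ℕ→ℚ-+ m n = toℚᵘ-injective (ℚᵘ.≃-trans (toℚᵘ-ℕ→ℚ (m ℕ.+ n)) (ℚᵘ.≃-trans sum≃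
    (ℚᵘ.≃-sym (ℚᵘ.≃-trans (toℚᵘ-homo-+ (ℕ→ℚ m) (ℕ→ℚ n)) (ℚᵘ.+-cong (toℚᵘ-ℕ→ℚ m) (toℚᵘ-ℕ→ℚ n))))))
    where
    sum≃ : mkℚᵘ (+ (m ℕ.+ n)) 0 ≃ᵘ mkℚᵘ (+ m) 0 ℚᵘ.+ mkℚᵘ (+ n) 0
    sum≃ = *≡* (cong (ℤ._* + 1) (trans (ℤ.pos-+ m n) (sym (cong₂ ℤ._+_ (ℤ.*-identityʳ (+ m)) (ℤ.*-identityʳ (+ n))))))

  ℕ→ℚ-* : ∀ m n → ℕ→ℚ (m ℕ.* n) ≡ ℕ→ℚ m * ℕ→ℚ n
  ℕ→ℚ-* m n = toℚᵘ-injective (ℚᵘ.≃-trans (toℚᵘ-ℕ→ℚ (m ℕ.* n)) (ℚᵘ.≃-trans product≃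
    (ℚᵘ.≃-sym (ℚᵘ.≃-trans (toℚᵘ-homo-* (ℕ→ℚ m) (ℕ→ℚ n)) (ℚᵘ.*-cong (toℚᵘ-ℕ→ℚ m) (toℚᵘ-ℕ→ℚ n))))))
    where
    product≃ : mkℚᵘ (+ (m ℕ.* n)) 0 ≃ᵘ mkℚᵘ (+ m) 0 ℚᵘ.* mkℚᵘ (+ n) 0
    product≃ = *≡* (cong (ℤ._* + 1) (ℤ.pos-* m n))

  ℕ→ℚ-mono-≤ : ∀ {m n} → m ℕ.≤ n → ℕ→ℚ m ≤ ℕ→ℚ n
  ℕ→ℚ-mono-≤ {m} {n} m≤n = toℚᵘ-cancel-≤ (ℚᵘ.≤-respˡ-≃ (ℚᵘ.≃-sym (toℚᵘ-ℕ→ℚ m)) (ℚᵘ.≤-respʳ-≃ (ℚᵘ.≃-sym (toℚᵘ-ℕ→ℚ n))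
    (*≤* (subst₂ ℤ._≤_ (sym (ℤ.*-identityʳ (+ m))) (sym (ℤ.*-identityʳ (+ n))) (+≤+ m≤n)))))

  ℕ→ℚ-cancel-≤ : ∀ {m n} → ℕ→ℚ m ≤ ℕ→ℚ n → m ℕ.≤ n
  ℕ→ℚ-cancel-≤ {m} {n} m≤n with ℚᵘ.≤-respˡ-≃ (toℚᵘ-ℕ→ℚ m) (ℚᵘ.≤-respʳ-≃ (toℚᵘ-ℕ→ℚ n) (toℚᵘ-mono-≤ m≤n))
  ... | *≤* m*1≤n*1 = ℤ.drop‿+≤+ (subst₂ ℤ._≤_ (ℤ.*-identityʳ (+ m)) (ℤ.*-identityʳ (+ n)) m*1≤n*1)

  1/n*n≡1 : ∀ m → (+ 1 / suc m) * ℕ→ℚ (suc m) ≡ 1ℚ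
  1/n*n≡1 m = toℚᵘ-injective (ℚᵘ.≃-trans (toℚᵘ-homo-* (+ 1 / suc m) (ℕ→ℚ (suc m)))
    (ℚᵘ.≃-trans (ℚᵘ.*-cong (toℚᵘ-fromℚᵘ (mkℚᵘ (+ 1) m)) (toℚᵘ-ℕ→ℚ (suc m))) (ℚᵘ.≃-trans product≃ (ℚᵘ.≃-sym (toℚᵘ-ℕ→ℚ 1)))))
    where
    product≃ : mkℚᵘ (+ 1) m ℚᵘ.* mkℚᵘ (+ suc m) 0 ≃ᵘ mkℚᵘ (+ 1) 0
    product≃ = *≡* (trans (ℤ.*-identityʳ _) (trans (ℤ.*-identityˡ (+ suc m)) (sym (trans (ℤ.*-identityˡ _) (cong (λ x → + suc x) (ℕ.*-identityʳ m))))))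

  a/B*B≡a : ∀ a b′ .(c : Coprime a (suc b′)) → mkℚ (+ a) b′ c * ℕ→ℚ (suc b′) ≡ ℕ→ℚ a
  a/B*B≡a a b′ c = toℚᵘ-injective (ℚᵘ.≃-trans (toℚᵘ-homo-* (mkℚ (+ a) b′ c) (ℕ→ℚ (suc b′)))
    (ℚᵘ.≃-trans (ℚᵘ.*-congˡ {mkℚᵘ (+ a) b′} (toℚᵘ-ℕ→ℚ (suc b′))) (ℚᵘ.≃-trans product≃ (ℚᵘ.≃-sym (toℚᵘ-ℕ→ℚ a)))))
    where
    product≃ : mkℚᵘ (+ a) b′ ℚᵘ.* mkℚᵘ (+ suc b′) 0 ≃ᵘ mkℚᵘ (+ a) 0
    product≃ = *≡* (trans (ℤ.*-identityʳ _) (sym (cong (λ x → + a ℤ.* + suc x) (ℕ.*-identityʳ b′))))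

  open ≤-Reasoning

  [½+a/B]*n≤δ⇒[B+2a]*n≤δ*2B : ∀ a b′ .(c : Coprime a (suc b′)) n δ → (½ + mkℚ (+ a) b′ c) * ℕ→ℚ n ≤ ℕ→ℚ δ →
    (suc b′ ℕ.+ 2 ℕ.* a) ℕ.* n ℕ.≤ δ ℕ.* (2 ℕ.* suc b′)
  [½+a/B]*n≤δ⇒[B+2a]*n≤δ*2B a b′ c n δ density = ℕ→ℚ-cancel-≤ (begin
    ℕ→ℚ ((suc b′ ℕ.+ 2 ℕ.* a) ℕ.* n) ≡⟨ lhs≡ ⟩
    ((½ + ε) * N) * K2B              ≤⟨ *-monoʳ-≤-nonNeg K2B ⦃ normalize-nonNeg (2 ℕ.* suc b′) 1 ⦄ density ⟩
    ℕ→ℚ δ * K2B                      ≡⟨ sym (ℕ→ℚ-* δ (2 ℕ.* suc b′)) ⟩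
    ℕ→ℚ (δ ℕ.* (2 ℕ.* suc b′))       ∎)
    where
    ε = mkℚ (+ a) b′ c
    N = ℕ→ℚ n
    B = ℕ→ℚ (suc b′)
    K2 = ℕ→ℚ 2
    Ka = ℕ→ℚ a
    K2B = ℕ→ℚ (2 ℕ.* suc b′)
    expand₁ : ∀ h ε N K2 B → ((h + ε) * N) * (K2 * B) ≡ (h * K2) * B * N + (ε * B) * K2 * N
    expand₁ = solve 5 (λ h ε N K2 B → ((h :+ ε) :* N) :* (K2 :* B) := (h :* K2) :* B :* N :+ (ε :* B) :* K2 :* N) refl
    expand₂ : ∀ B K2 Ka N → (B + K2 * Ka) * N ≡ 1ℚ * B * N + Ka * K2 * N
    expand₂ = solve 4 (λ B K2 Ka N → (B :+ K2 :* Ka) :* N := con 1ℚ :* B :* N :+ Ka :* K2 :* N) refl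
    lhs≡ : ℕ→ℚ ((suc b′ ℕ.+ 2 ℕ.* a) ℕ.* n) ≡ ((½ + ε) * N) * K2B
    lhs≡ = begin-equality
      ℕ→ℚ ((suc b′ ℕ.+ 2 ℕ.* a) ℕ.* n)
        ≡⟨ trans (ℕ→ℚ-* (suc b′ ℕ.+ 2 ℕ.* a) n) (cong (_* N) (trans (ℕ→ℚ-+ (suc b′) (2 ℕ.* a)) (cong (λ z → B + z) (ℕ→ℚ-* 2 a)))) ⟩
      (B + K2 * Ka) * N                      ≡⟨ expand₂ B K2 Ka N ⟩
      1ℚ * B * N + Ka * K2 * N               ≡⟨ sym (cong₂ (λ x y → x * B * N + y * K2 * N) (1/n*n≡1 1) (a/B*B≡a a b′ c)) ⟩
      (½ * K2) * B * N + (ε * B) * K2 * N    ≡⟨ sym (expand₁ ½ ε N K2 B) ⟩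
      ((½ + ε) * N) * (K2 * B)               ≡⟨ cong (((½ + ε) * N) *_) (sym (ℕ→ℚ-* 2 (suc b′))) ⟩
      ((½ + ε) * N) * K2B                    ∎

  [B+a]*s≤δ*2B⇒[½+a/B*½]*s≤δ : ∀ a b′ .(c : Coprime a (suc b′)) s δ → (suc b′ ℕ.+ a) ℕ.* s ℕ.≤ δ ℕ.* (2 ℕ.* suc b′) →
    (½ + mkℚ (+ a) b′ c * ½) * ℕ→ℚ s ≤ ℕ→ℚ δ
  [B+a]*s≤δ*2B⇒[½+a/B*½]*s≤δ a b′ c s δ bound = *-cancelʳ-≤-pos K2B ⦃ normalize-pos (2 ℕ.* suc b′) 1 ⦄ (begin
    ((½ + ε * ½) * S) * K2B          ≡⟨ lhs≡ ⟩
    ℕ→ℚ ((suc b′ ℕ.+ a) ℕ.* s)       ≤⟨ ℕ→ℚ-mono-≤ bound ⟩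
    ℕ→ℚ (δ ℕ.* (2 ℕ.* suc b′))       ≡⟨ ℕ→ℚ-* δ (2 ℕ.* suc b′) ⟩
    ℕ→ℚ δ * K2B                      ∎)
    where
    ε = mkℚ (+ a) b′ c
    S = ℕ→ℚ s
    B = ℕ→ℚ (suc b′)
    K2 = ℕ→ℚ 2
    Ka = ℕ→ℚ a
    K2B = ℕ→ℚ (2 ℕ.* suc b′)
    expand₁ : ∀ h ε S K2 B → ((h + ε * h) * S) * (K2 * B) ≡ (h * K2) * B * S + (ε * B) * (h * K2) * S
    expand₁ = solve 5 (λ h ε S K2 B → ((h :+ ε :* h) :* S) :* (K2 :* B) := (h :* K2) :* B :* S :+ (ε :* B) :* (h :* K2) :* S) refl
    expand₂ : ∀ B Ka S → (B + Ka) * S ≡ 1ℚ * B * S + Ka * 1ℚ * S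
    expand₂ = solve 3 (λ B Ka S → (B :+ Ka) :* S := con 1ℚ :* B :* S :+ Ka :* con 1ℚ :* S) refl
    lhs≡ : ((½ + ε * ½) * S) * K2B ≡ ℕ→ℚ ((suc b′ ℕ.+ a) ℕ.* s)
    lhs≡ = begin-equality
      ((½ + ε * ½) * S) * K2B                    ≡⟨ cong (((½ + ε * ½) * S) *_) (ℕ→ℚ-* 2 (suc b′)) ⟩
      ((½ + ε * ½) * S) * (K2 * B)               ≡⟨ expand₁ ½ ε S K2 B ⟩
      (½ * K2) * B * S + (ε * B) * (½ * K2) * S  ≡⟨ cong₂ (λ x y → x * B * S + y * x * S) (1/n*n≡1 1) (a/B*B≡a a b′ c) ⟩
      1ℚ * B * S + Ka * 1ℚ * S                   ≡⟨ sym (expand₂ B Ka S) ⟩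
      (B + Ka) * S                               ≡⟨ sym (trans (ℕ→ℚ-* (suc b′ ℕ.+ a) s) (cong (_* S) (ℕ→ℚ-+ (suc b′) a))) ⟩
      ℕ→ℚ ((suc b′ ℕ.+ a) ℕ.* s)                 ∎

  [1-1/s²]*N≤D : ∀ s .⦃ _ : ℕ.NonZero s ⦄ N D X → N ℕ.≤ D ℕ.+ X → s ℕ.* s ℕ.* X ℕ.≤ N →
    (1ℚ - (+ 1 / s) * (+ 1 / s)) * ℕ→ℚ N ≤ ℕ→ℚ D
  [1-1/s²]*N≤D (suc s′) N D X N≤D+X s²X≤N = begin
    (1ℚ - y) * Nq        ≡⟨ expand₁ y Nq ⟩
    Nq + - (y * Nq)      ≤⟨ +-mono-≤ (≤-trans (ℕ→ℚ-mono-≤ N≤D+X) (≤-reflexive (ℕ→ℚ-+ D X))) (neg-antimono-≤ Xq≤yN) ⟩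
    (Dq + Xq) + - Xq     ≡⟨ expand₂ Dq Xq ⟩
    Dq                   ∎
    where
    i = + 1 / suc s′
    y = i * i
    Nq = ℕ→ℚ N
    Dq = ℕ→ℚ D
    Xq = ℕ→ℚ X
    Sq = ℕ→ℚ (suc s′)
    expand₁ : ∀ y N → (1ℚ - y) * N ≡ N + - (y * N)
    expand₁ = solve 2 (λ y N → (con 1ℚ :- y) :* N := N :+ :- (y :* N)) refl
    expand₂ : ∀ d x → (d + x) + - x ≡ d
    expand₂ = solve 2 (λ d x → (d :+ x) :+ :- x := d) refl
    regroup : ∀ i S x → (i * i) * (S * S * x) ≡ (i * S) * (i * S) * x
    regroup = solve 3 (λ i S x → (i :* i) :* (S :* S :* x) := (i :* S) :* (i :* S) :* x) refl
    unit : ∀ x → 1ℚ * 1ℚ * x ≡ x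
    unit = solve 1 (λ x → con 1ℚ :* con 1ℚ :* x := x) refl
    Xq≤yN : Xq ≤ y * Nq
    Xq≤yN = begin
      Xq                                         ≡⟨ sym (unit Xq) ⟩
      1ℚ * 1ℚ * Xq                               ≡⟨ cong (λ z → z * z * Xq) (sym (1/n*n≡1 s′)) ⟩
      (i * Sq) * (i * Sq) * Xq                   ≡⟨ sym (regroup i Sq Xq) ⟩
      y * (Sq * Sq * Xq)                         ≡⟨ cong (y *_) (sym (trans (ℕ→ℚ-* (suc s′ ℕ.* suc s′) X) (cong (_* Xq) (ℕ→ℚ-* (suc s′) (suc s′))))) ⟩
      y * ℕ→ℚ (suc s′ ℕ.* suc s′ ℕ.* X)
        ≤⟨ *-monoˡ-≤-nonNeg y ⦃ nonNeg*nonNeg⇒nonNeg i ⦃ normalize-nonNeg 1 (suc s′) ⦄ i ⦃ normalize-nonNeg 1 (suc s′) ⦄ ⦄ (ℕ→ℚ-mono-≤ s²X≤N) ⟩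
      y * Nq                                     ∎

module MinimumDegree (a′ b′ k : ℕ) .(coprime : Coprime (ℕ.suc a′) (ℕ.suc b′)) where

  open import Data.Bool using (Bool; T; _∧_; not; _∨_)
  open import Data.Bool.ListAction using (any)
  open import Data.Vec using (lookup)
  open import Data.Fin using (Fin)
  import Data.Fin as Fin
  open import Data.Fin.Subset using (Subset; ⊤; ⁅_⁆; ∣_∣)
  open import Data.Fin.Subset.Properties using (∣⊤∣≡n; ∈⊤)
  open import Data.Integer using (+_)
  open import Data.List.Membership.Propositional using (find)
  open import Data.List.Membership.Propositional.Properties using (∈-map⁺; ∈-map⁻; ∈-allFin)
  open import Data.List.Relation.Unary.Any.Properties using (any⁻)
  open import Data.Nat hiding (_/_)
  open import Data.Nat using () renaming (_/_ to _div_)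
  open import Data.Nat.Combinatorics using (_C_)
  open import Data.Nat.DivMod using (m/n*n≤m)
  open import Data.Nat.Properties
  open import Data.Nat.Tactic.RingSolver using (solve-∀)
  open import Data.Product using (_,_; proj₁; proj₂)
  import Data.Rational as ℚ
  open import Data.Rational using (ℚ; mkℚ; ½; 1ℚ; _/_)
  import Data.Rational.Properties as ℚ
  open import Relation.Binary.PropositionalEquality
  open import Relation.Nullary using (¬_)
  open import Function using (_∘_)
  open Combinatorics
  open Rational using ([½+a/B]*n≤δ⇒[B+2a]*n≤δ*2B; [B+a]*s≤δ*2B⇒[½+a/B*½]*s≤δ; [1-1/s²]*N≤D)

  -- ε = a/B. A k-graph in 𝒫(ε) forces 2a ≤ B (see b≡B), so b = 2a + e equals B; for ε > 1/2
  -- no k-graph qualifies and e is a junk value.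
  a B e : ℕ
  a = suc a′
  B = suc b′
  e = B ∸ 2 * a

  ε : ℚ
  ε = mkℚ (+ a) b′ coprime

  open Tail a e k (s≤s z≤n)

  G : ℕ
  G = 4 * b * c * (k + 3)

  instance
    G≢0 : NonZero G
    G≢0 = >-nonZero (*-mono-≤ {1} {4 * b * c} (*-mono-≤ {1} {4 * b} (≤-trans 1≤b (m≤n*m b 4)) 1≤c) (≤-trans (s≤s z≤n) (m≤n+m 3 k)))

  s₀ : ℕ
  s₀ = 4 * b * k + (8 * A⁺ * e * k + 1) + G * (2 * G + 4)

  -- L s ratio steps: 4bL ≤ s, and (d/c)^L ≥ 2^((k+3)⌊s/G⌋) beats s²(s+1)^(k+1) once s ≥ G(2G+4).
  L : ℕ → ℕ
  L s = c * ((k + 3) * (s div G))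

  n₀ : ℕ → ℕ
  n₀ s = 2 * b * (s + 1) + 2 * A⁺ * (A⁻ * s) * (2 * b * (e * (s + 1) + P)) + 1

  module _ {s : ℕ} (s₀≤s : s₀ ≤ s) where

    E : ℕ
    E = A⁻ * s ∸ 4 * b * k

    private
      4bk+8A⁺ek+1≤A⁻s : 4 * b * k + (8 * A⁺ * e * k + 1) ≤ A⁻ * s
      4bk+8A⁺ek+1≤A⁻s = ≤-trans (m≤m+n _ (G * (2 * G + 4))) (≤-trans s₀≤s (m≤n*m s A⁻ ⦃ >-nonZero (≤-trans (s≤s z≤n) (m≤m+n a (2 * e))) ⦄))

    s≡ : A⁻ * s ≡ 4 * b * k + E
    s≡ = sym (m+[n∸m]≡n (m+n≤o⇒m≤o (4 * b * k) 4bk+8A⁺ek+1≤A⁻s))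

    E-large : 8 * A⁺ * e * k + 1 ≤ E
    E-large = m+n≤o⇒m≤o∸n (8 * A⁺ * e * k + 1) (≤-trans (≤-reflexive (+-comm _ (4 * b * k))) 4bk+8A⁺ek+1≤A⁻s)

    4bL≤as : 4 * b * L s ≤ a * s
    4bL≤as = begin
      4 * b * (c * ((k + 3) * (s div G))) ≡⟨ regroup b c k (s div G) ⟩
      s div G * G                         ≤⟨ m/n*n≤m s G ⟩
      s                                   ≤⟨ m≤n*m s a ⟩
      a * s                               ∎
      where
      open ≤-Reasoning
      regroup : ∀ b c k z → 4 * b * (c * ((k + 3) * z)) ≡ z * (4 * b * c * (k + 3))
      regroup = solve-∀

    poly≤exp : s * s * suc s ^ (k + 1) * c ^ L s ≤ d ^ L s
    poly≤exp = polynomial≤exponential c d k s (s div G) 1≤c c<d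
                 (1+s≤2^[s/G] G s (m+n≤o⇒n≤o (4 * b * k + (8 * A⁺ * e * k + 1)) s₀≤s))

  module _ {s n : ℕ} (n₀≤n : n₀ s ≤ n) where

    F : ℕ
    F = P * n ∸ 2 * b * (s + 1)

    private
      n₀≤Pn : n₀ s ≤ P * n
      n₀≤Pn = ≤-trans n₀≤n (m≤n*m n P ⦃ >-nonZero 1≤P ⦄)

    n≡ : P * n ≡ 2 * b * (s + 1) + F
    n≡ = sym (m+[n∸m]≡n (m+n≤o⇒m≤o (2 * b * (s + 1)) (m+n≤o⇒m≤o (2 * b * (s + 1) + 2 * A⁺ * (A⁻ * s) * (2 * b * (e * (s + 1) + P))) n₀≤Pn)))

    F-large : 2 * A⁺ * (A⁻ * s) * (2 * b * (e * (s + 1) + P)) < F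
    F-large = m+n≤o⇒m≤o∸n _ (≤-trans (≤-reflexive (regroup (2 * b * (s + 1)) _)) n₀≤Pn)
      where
      regroup : ∀ x y → suc y + x ≡ x + y + 1
      regroup = solve-∀

    1≤n : 1 ≤ n
    1≤n = m+n≤o⇒n≤o _ n₀≤n

  module _ (k≥1 : 1 ≤ k) {n : ℕ} (H : KGraph k n) (H∈𝒫 : InP ε H) (1≤n : 1 ≤ n) where

    private
      δ⊤ = δstar H ⊤

      [B+2a]*n≤δ⊤*2B : (B + 2 * a) * n ≤ δ⊤ * (2 * B)
      [B+2a]*n≤δ⊤*2B = subst (λ m → (B + 2 * a) * m ≤ δ⊤ * (2 * B)) (∣⊤∣≡n n)
        ([½+a/B]*n≤δ⇒[B+2a]*n≤δ*2B a b′ coprime ∣ ⊤ {n} ∣ δ⊤ (ℚ.≤ᵇ⇒≤ (proj₁ (T-∧⁻ H∈𝒫))))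

      2a≤B : 2 * a ≤ B
      2a≤B = +-cancelˡ-≤ B _ _ (*-cancelʳ-≤ (B + 2 * a) (B + B) n ⦃ >-nonZero 1≤n ⦄ (begin
        (B + 2 * a) * n   ≤⟨ [B+2a]*n≤δ⊤*2B ⟩
        δ⊤ * (2 * B)      ≤⟨ *-monoˡ-≤ (2 * B) (δstar≤n H k≥1 ⊤) ⟩
        n * (2 * B)       ≡⟨ regroup n B ⟩
        (B + B) * n       ∎))
        where
        open ≤-Reasoning
        regroup : ∀ n B → n * (2 * B) ≡ (B + B) * n
        regroup = solve-∀

    b≡B : b ≡ B
    b≡B = m+[n∸m]≡n 2a≤B

    dense : ∀ {A} → ∣ A ∣ ≡ k ∸ 1 → 0 < codeg H ⊤ A → P * n ≤ 2 * b * codeg H ⊤ A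
    dense {A} ∣A∣≡ codeg>0 = begin
      P * n                  ≡⟨ cong (_* n) (trans (regroup a e) (cong (λ m → m + 2 * a) b≡B)) ⟩
      (B + 2 * a) * n        ≤⟨ [B+2a]*n≤δ⊤*2B ⟩
      δ⊤ * (2 * B)           ≤⟨ *-monoˡ-≤ (2 * B) (δstar≤codeg H ∣A∣≡ codeg>0) ⟩
      codeg H ⊤ A * (2 * B)  ≡⟨ trans (*-comm (codeg H ⊤ A) (2 * B)) (cong (λ m → 2 * m * codeg H ⊤ A) (sym b≡B)) ⟩
      2 * b * codeg H ⊤ A    ∎
      where
      open ≤-Reasoning
      regroup : ∀ a e → 4 * a + e ≡ (2 * a + e) + 2 * a
      regroup = solve-∀

    singletons-in-edges : ∀ u → InEdge H ⁅ u ⁆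
    singletons-in-edges u with find (any⁻ lies-in-edge (allSubsets n) (subst (λ x → T (not x ∨ any lies-in-edge (allSubsets n)))
                                                 (T⇒≡true (∈⇒T-lookup (∈⊤ {x = u}))) (T-all-allFin⁻ (proj₂ (T-∧⁻ H∈𝒫)) u)))
      where
      lies-in-edge : Subset n → Bool
      lies-in-edge E = inducedEdge H ⊤ E ∧ lookup E u
    ... | E , _ , chosen = let induced , u∈E = T-∧⁻ {inducedEdge H ⊤ E} chosen in
      E , proj₁ (T-∧⁻ {edge H E} induced) , x∈p⇒⁅x⁆⊆p (T-lookup⇒∈ u∈E)

    large-δstar⇒𝒫 : ∀ {s S} → ∣ S ∣ ≡ s → (b + a) * s ≤ 2 * b * δstar H S → T (noIsolatedᵇ H S) → T (inPᵇ H (ε ℚ.* ½) S)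
    large-δstar⇒𝒫 {s} {S} ∣S∣≡s large noIsolated = T-∧⁺ (ℚ.≤⇒≤ᵇ codegree-bound) noIsolated
      where
      [B+a]*s≤δ*2B : (B + a) * s ≤ δstar H S * (2 * B)
      [B+a]*s≤δ*2B = subst₂ _≤_ (cong (λ m → (m + a) * s) b≡B) (trans (cong (λ m → 2 * m * δstar H S) b≡B) (*-comm (2 * B) (δstar H S))) large
      codegree-bound : (½ ℚ.+ ε ℚ.* ½) ℚ.* ℕ→ℚ ∣ S ∣ ℚ.≤ ℕ→ℚ (δstar H S)
      codegree-bound = subst (λ m → (½ ℚ.+ ε ℚ.* ½) ℚ.* ℕ→ℚ m ℚ.≤ ℕ→ℚ (δstar H S)) (sym ∣S∣≡s)
                             ([B+a]*s≤δ*2B⇒[½+a/B*½]*s≤δ a b′ coprime s (δstar H S) [B+a]*s≤δ*2B)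

    module _ {s : ℕ} ⦃ _ : NonZero s ⦄ (s₀≤s : s₀ ≤ s) (n₀≤n : n₀ s ≤ n) (v : Fin n) where
      open BadSets H k≥1 a e (s≤s z≤n) v

      private
        1≤[b+a]s : 1 ≤ (b + a) * s
        1≤[b+a]s = *-mono-≤ (≤-trans (s≤s z≤n) (m≤n+m a b)) (>-nonZero⁻¹ s)

        in-𝒫-unless-bad : ∀ S → T (∣ S ∣ ≡ᵇ s) → T (lookup S v) → ¬ T (bad s S) → T (inPᵇ H (ε ℚ.* ½) S)
        in-𝒫-unless-bad S ∣S∣≡s v∈S ¬bad = large-δstar⇒𝒫 (≡ᵇ⇒≡ ∣ S ∣ s ∣S∣≡s)
          (θ≤q*δstar H v (2 * b) ((b + a) * s) 1≤[b+a]s (not-bad s ¬bad) k≥1 (T-lookup⇒∈ v∈S) (singletons-in-edges v))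
          (noIsolated H v (2 * b) ((b + a) * s) 1≤[b+a]s (not-bad s ¬bad) k≥1 singletons-in-edges)

        good-or-bad : countˢ (base s) ≤ pgDeg H (ε ℚ.* ½) s v + countˢ (λ S → base s S ∧ bad s S)
        good-or-bad = begin
          countˢ (base s)
            ≤⟨ sumˢ-mono-≤ (λ S → χ-split (∣ S ∣ ≡ᵇ s) (lookup S v) (inPᵇ H (ε ℚ.* ½) S) (bad s S) (in-𝒫-unless-bad S)) ⟩
          sumˢ (λ S → χ (in-𝒫 S) + χ (base s S ∧ bad s S))
            ≡⟨ sumˢ-+ (χ ∘ in-𝒫) (λ S → χ (base s S ∧ bad s S)) ⟩
          countˢ in-𝒫 + countˢ (λ S → base s S ∧ bad s S)
            ≡⟨ cong (_+ countˢ (λ S → base s S ∧ bad s S)) (sym (length-filterᵇ-allSubsets in-𝒫)) ⟩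
          pgDeg H (ε ℚ.* ½) s v + countˢ (λ S → base s S ∧ bad s S) ∎
          where
          open ≤-Reasoning
          in-𝒫 : Subset n → Bool
          in-𝒫 S = (∣ S ∣ ≡ᵇ s) ∧ lookup S v ∧ inPᵇ H (ε ℚ.* ½) S

      vertex-bound : (1ℚ ℚ.- (+ 1 / s) ℚ.* (+ 1 / s)) ℚ.* ℕ→ℚ ((n ∸ 1) C (s ∸ 1)) ℚ.≤ ℕ→ℚ (pgDeg H (ε ℚ.* ½) s v)
      vertex-bound = subst (λ N → (1ℚ ℚ.- (+ 1 / s) ℚ.* (+ 1 / s)) ℚ.* ℕ→ℚ N ℚ.≤ ℕ→ℚ (pgDeg H (ε ℚ.* ½) s v))
        (count-∋-size v s (>-nonZero⁻¹ s))
        ([1-1/s²]*N≤D s (countˢ (base s)) (pgDeg H (ε ℚ.* ½) s v) (countˢ (λ S → base s S ∧ bad s S)) good-or-bad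
          (few-bad dense {s} {E s₀≤s} {F {s} n₀≤n} (s≡ s₀≤s) (E-large s₀≤s) (n≡ {s} n₀≤n) (F-large {s} n₀≤n) (L s) (4bL≤as s₀≤s) (poly≤exp s₀≤s)))

  degree-bound : (k≥1 : 1 ≤ k) (s : ℕ) ⦃ _ : NonZero s ⦄ → s₀ ≤ s → (n : ℕ) → n₀ s ≤ n → (H : KGraph k n) → InP ε H →
    (1ℚ ℚ.- (+ 1 / s) ℚ.* (+ 1 / s)) ℚ.* ℕ→ℚ ((n ∸ 1) C (s ∸ 1)) ℚ.≤ ℕ→ℚ (δ₁PG H (ε ℚ.* ½) s)
  degree-bound k≥1 s s₀≤s n n₀≤n H H∈𝒫 =
    subst (λ m → (1ℚ ℚ.- (+ 1 / s) ℚ.* (+ 1 / s)) ℚ.* ℕ→ℚ ((n ∸ 1) C (s ∸ 1)) ℚ.≤ ℕ→ℚ m) (sym δ₁≡deg)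
      (vertex-bound k≥1 H H∈𝒫 (1≤n {s} n₀≤n) s₀≤s n₀≤n v)
    where
    attained = ∈-map⁻ (pgDeg H (ε ℚ.* ½) s) (minList-∈ (∈-map⁺ (pgDeg H (ε ℚ.* ½) s) (∈-allFin (Fin.fromℕ< (1≤n {s} n₀≤n)))))
    v = proj₁ attained
    δ₁≡deg = proj₂ (proj₂ attained)

open import Data.Nat using (ℕ; _≤_; _∸_; NonZero)
open import Data.Nat.Combinatorics using (_C_)
open import Data.Integer using (+_)
open import Data.Rational using (ℚ; 0ℚ; 1ℚ; _/_; ½; _<_; _-_; _*_) renaming (_≤_ to _≤ℚ_)
open import Data.Product using (∃-syntax)

open import Data.Integer using (-[1+_]; +<+)
open import Data.Rational using (mkℚ; *<*)
open import Data.Product using (_,_)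

corollary3p9 : (k : ℕ) → 1 ≤ k → (ε : ℚ) → 0ℚ < ε →
    ∃[ s₀ ] ((s : ℕ) → ⦃ _ : NonZero s ⦄ → s₀ ≤ s →
    ∃[ n₀ ] ((n : ℕ) → n₀ ≤ n → (H : KGraph k n) → InP ε H →
    (1ℚ - (+ 1 / s) * (+ 1 / s)) * ℕ→ℚ ((n ∸ 1) C (s ∸ 1))
    ≤ℚ ℕ→ℚ (δ₁PG H (ε * ½) s)))
corollary3p9 k k≥1 (mkℚ (+ ℕ.suc a′) b′ coprime) _ = s₀ , λ s s₀≤s → n₀ s , degree-bound k≥1 s s₀≤s
  where open MinimumDegree a′ b′ k coprime
corollary3p9 k k≥1 (mkℚ (+ ℕ.zero) b′ _) (*<* (+<+ ()))
corollary3p9 k k≥1 (mkℚ -[1+ _ ] b′ _) (*<* ())
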